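{- Let $H_1,\dots,H_k$ be connected graphs with distinguished vertices $w_i\in V(H_i)$ such that $(H_i,w_i)\not\cong(H_j,w_j)$ for all $i\neq j$ in $[k]$. Suppose that either (Case 1) every $H_i$ is reflexive, or (Case 2) every $H_i$ is an irreflexive bipartite graph with at least one edge. Then (i) there exists a connected irreflexive graph $G$ with a distinguished vertex $v\in V(G)$ such that for all $i\neq j$ in $[k]$, $\hom((G,v)\to(H_i,w_i))\neq\hom((G,v)\to(H_j,w_j))$; and (ii) in Case 2, $G$ can moreover be taken to be bipartite with at least one edge.
   Context: Graphs are finite, undirected, possibly with loops; reflexive means every vertex has a loop, irreflexive means none does. A homomorphism $h:V(G)\to V(H)$ maps each edge of $G$ to an edge of $H$. For $v\in V(G)$ and $w\in V(H)$, $\hom((G,v)\to(H,w))$ is the number of homomorphisms $h$ from $G$ to $H$ with $h(v)=w$. $(G,v)\cong(H,w)$ means there is a graph isomorphism from $G$ to $H$ mapping $v$ to $w$. -}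

module Defs where

open import Data.Nat using (ℕ; zero; suc)
open import Data.Fin using (Fin; _≟_)
import Data.Bool
import Data.Empty
import Data.List.Relation.Unary.All
import Data.List.Membership.Propositional.Properties
open import Data.Bool using (Bool; true; false)
open import Data.List using (List; []; _∷_; map; concatMap; filter; length; allFin)
open import Data.Vec using (Vec; []; _∷_; lookup)
open import Data.Product using (Σ; ∃; _×_; _,_)
open import Relation.Binary.PropositionalEquality using (_≡_; _≢_)
open import Relation.Nullary using (¬_; Dec)
open import Relation.Nullary.Decidable using (yes; no)
open import Data.List.Relation.Unary.All using (All; all?)

record Graph : Set where
  field
    n   : ℕ
    adj : Fin n → Fin n → Bool
    adj-sym : ∀ x y → adj x y ≡ adj y x
open Graph public

Vertex : Graph → Set
Vertex G = Fin (n G)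

Edge : (G : Graph) → Vertex G → Vertex G → Set
Edge G x y = adj G x y ≡ true

Reflexive : Graph → Set
Reflexive G = ∀ x → Edge G x x

Irreflexive : Graph → Set
Irreflexive G = ∀ x → adj G x x ≡ false

HasEdge : Graph → Set
HasEdge G = ∃ λ x → ∃ λ y → Edge G x y

Bipartite : Graph → Set
Bipartite G = Σ (Vertex G → Bool) λ c → ∀ x y → Edge G x y → c x ≢ c y

data Reach (G : Graph) : Vertex G → Vertex G → Set where
  here : ∀ {x} → Reach G x x
  step : ∀ {x y z} → Edge G x y → Reach G y z → Reach G x z

-- connected (non-emptiness is supplied by distinguished vertices where used)
Connected : Graph → Set
Connected G = ∀ x y → Reach G x y

RootedIso : (G : Graph) → Vertex G → (H : Graph) → Vertex H → Set
RootedIso G v H w =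
  Σ (Vertex G → Vertex H) λ f → Σ (Vertex H → Vertex G) λ g →
    (∀ x → g (f x) ≡ x) × (∀ y → f (g y) ≡ y) ×
    (∀ x y → adj G x y ≡ adj H (f x) (f y)) × (f v ≡ w)

-- maps V(G) → V(H) represented as vectors (h x = lookup h x)
allMaps : (a b : ℕ) → List (Vec (Fin b) a)
allMaps zero    b = [] ∷ []
allMaps (suc a) b = concatMap (λ i → map (i ∷_) (allMaps a b)) (allFin b)

IsRootedHom : (G : Graph) → Vertex G → (H : Graph) → Vertex H → Vec (Fin (n H)) (n G) → Set
IsRootedHom G v H w h =
  (∀ x y → Edge G x y → Edge H (lookup h x) (lookup h y)) × (lookup h v ≡ w)

isRootedHom? : (G : Graph) (v : Vertex G) (H : Graph) (w : Vertex H) →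
  (h : Vec (Fin (n H)) (n G)) → Dec (IsRootedHom G v H w h)
isRootedHom? G v H w h with all? (λ x → all? (λ y → imp x y) (allFin (n G))) (allFin (n G)) | lookup h v ≟ w
  where
  imp : ∀ x y → Dec (Edge G x y → Edge H (lookup h x) (lookup h y))
  imp x y with adj G x y Data.Bool.≟ true | adj H (lookup h x) (lookup h y) Data.Bool.≟ true
  ... | _ | yes q = yes (λ _ → q)
  ... | no p | _ = yes (λ e → Data.Empty.⊥-elim (p e))
  ... | yes p | no q = no (λ f → q (f p))
... | yes a | yes e = yes ((λ x y → Data.List.Relation.Unary.All.lookup
                                (Data.List.Relation.Unary.All.lookup a (Data.List.Membership.Propositional.Properties.∈-allFin x))
                                (Data.List.Membership.Propositional.Properties.∈-allFin y)) , e)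
... | _ | no e = no (λ p → e (Data.Product.proj₂ p))
... | no a | _ = no (λ p → a (Data.List.Relation.Unary.All.tabulate
                     (λ {x} _ → Data.List.Relation.Unary.All.tabulate (λ {y} _ → Data.Product.proj₁ p x y))))

homCount : (G : Graph) → Vertex G → (H : Graph) → Vertex H → ℕ
homCount G v H w = length (filter (isRootedHom? G v H w) (allMaps (n G) (n H)))

-- A pair (H₁ , w₁) ≇ (H₂ , w₂) is separated by a Lovász-style argument. Counting rooted
-- homomorphisms F → H subject to constraints "x and y have distinct images" or "x and y have
-- non-adjacent images" reduces to unconstrained counts: dropping a constraint adds back the maps
-- violating it, and these are the homomorphisms from F with x and y merged, resp. from F with the
-- edge xy added, both again connected (and with an edge). So if no connected rooted graph told H₁
-- and H₂ apart, the number of induced embeddings of H₁ into H₂ would equal the (positive) number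
-- into H₁ itself; symmetrically H₂ embeds into H₁, and two injective induced embeddings force an
-- isomorphism. For reflexive targets the loops of F are irrelevant, so F may be taken loopless; a
-- graph with a nonzero count into an irreflexive bipartite target is itself irreflexive bipartite.
--
-- Gluing rooted graphs at their roots multiplies counts. If G₁ separates some pairs and G₂ one
-- more pair, then in G₁^(M+1) glued to G₂ the counts x^(M+1)·y still determine x and y, because
-- all counts are positive and M ≥ x·y (Bernoulli's inequality). Iterating over all pairs gives a
-- single separating graph.

module Submission where

open import Defs
open import Data.Bool as Bool using (Bool; true; false; not)
open import Data.Bool.Properties using (not-injective; ¬-not)
open import Data.Empty using (⊥-elim)
open import Data.Fin as Fin using (Fin; zero; suc; punchIn; punchOut; _↑ˡ_; _↑ʳ_; splitAt)
open import Data.Fin.Properties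
  using (any?; injective⇒≤; punchInᵢ≢i; punchIn-punchOut; punchOut-punchIn; punchOut-cong; punchOut-injective;
         splitAt-↑ˡ; splitAt-↑ʳ; splitAt⁻¹-↑ˡ; splitAt⁻¹-↑ʳ)
open import Data.List as List using (List; []; _∷_; allFin; concatMap; cartesianProduct; filter; length)
import Data.List.Properties as List
open import Data.List.Membership.Propositional using (_∈_)
open import Data.List.Membership.Propositional.Properties using (∈-allFin; ∈-cartesianProduct⁺)
open import Data.List.Relation.Unary.All as All using (All; []; _∷_; all?)
open import Data.List.Relation.Unary.All.Properties using (concat⁺; concat⁻; map⁺; map⁻)
open import Data.List.Relation.Unary.Any using (here; there)
open import Data.Nat as ℕ using (ℕ; zero; suc; pred; _+_; _*_; _^_; _≤_; _<_; z≤n; s≤s; >-nonZero)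
open import Data.Nat.ListAction using () renaming (sum to listSum)
open import Data.Nat.ListAction.Properties using () renaming (sum-++ to listSum-++)
open import Data.Nat.Properties
  using (+-*-semiring; +-identityʳ; *-identityʳ; *-distribˡ-+; +-cancelʳ-≡; *-cancelˡ-≡; *-cancelˡ-<; *-mono-≤;
         *-monoʳ-≤; *-monoʳ-<; ^-monoˡ-≤; m^n≢0; m<n+m; m≤m*n; m≤m+n; m≤n+m; n≤1+n; n≤0⇒n≡0; n≢0⇒n>0;
         ≤-refl; ≤-reflexive; ≤-trans; ≮⇒≥; <-cmp; <-irrefl; <⇒≢; module ≤-Reasoning)
open import Data.Nat.Tactic.RingSolver using (solve-∀)
open import Algebra.Properties.Semiring.Sum +-*-semiring
  using (sum; sum-syntax; sum-cong-≗; sum-remove; sum-replicate-zero; ∑-comm; ∑-distrib-+;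
         *-distribʳ-sum; *-distribˡ-sum)
open import Data.Product using (Σ; ∃; _×_; _,_; proj₁; proj₂)
open import Data.Sum using (_⊎_; inj₁; inj₂; [_,_]′)
open import Data.Vec using (Vec; []; _∷_; lookup; insertAt; tabulate; _++_)
open import Data.Vec.Properties using (insertAt-lookup; insertAt-punchIn; lookup-++ˡ; lookup-++ʳ; lookup∘tabulate)
open import Function using (_∘_; id; const; _⇔_; mk⇔; Equivalence; Injective)
import Function.Properties.Equivalence as ⇔
open import Level using (0ℓ)
open import Relation.Binary.Definitions using (tri<; tri≈; tri>)
open import Relation.Binary.PropositionalEquality
open import Relation.Nullary using (Dec; yes; no; ¬_; does; _×-dec_; _⊎-dec_; ¬?)
open import Relation.Nullary.Decidable using (does-⇔)
open import Relation.Unary using (Pred; Decidable)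

-- Counting maps between finite sets

𝟙 : ∀ {ℓ} {A : Set ℓ} → Dec A → ℕ
𝟙 (yes _) = 1
𝟙 (no _)  = 0

module _ {ℓ} {A : Set ℓ} where

  𝟙-yes : (a? : Dec A) → A → 𝟙 a? ≡ 1
  𝟙-yes (yes _) _  = refl
  𝟙-yes (no ¬a) a = ⊥-elim (¬a a)

  𝟙-no : (a? : Dec A) → ¬ A → 𝟙 a? ≡ 0
  𝟙-no (yes a) ¬a = ⊥-elim (¬a a)
  𝟙-no (no _)  _  = refl

  𝟙-positive : (a? : Dec A) → 0 < 𝟙 a? → A
  𝟙-positive (yes a) _ = a

  𝟙-complement : (a? : Dec A) → 𝟙 (¬? a?) + 𝟙 a? ≡ 1
  𝟙-complement (yes _) = refl
  𝟙-complement (no _)  = refl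

𝟙-⇔ : ∀ {ℓ ℓ′} {A : Set ℓ} {B : Set ℓ′} (a? : Dec A) (b? : Dec B) → A ⇔ B → 𝟙 a? ≡ 𝟙 b?
𝟙-⇔ (yes _) (yes _) _   = refl
𝟙-⇔ (yes a) (no ¬b) A⇔B = ⊥-elim (¬b (Equivalence.to A⇔B a))
𝟙-⇔ (no ¬a) (yes b) A⇔B = ⊥-elim (¬a (Equivalence.from A⇔B b))
𝟙-⇔ (no _)  (no _)  _   = refl

𝟙-× : ∀ {ℓ ℓ′} {A : Set ℓ} {B : Set ℓ′} (a? : Dec A) (b? : Dec B) → 𝟙 (a? ×-dec b?) ≡ 𝟙 a? * 𝟙 b?
𝟙-× (yes _) (yes _) = refl
𝟙-× (yes _) (no _)  = refl
𝟙-× (no _)  _       = refl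

term≤sum : ∀ {b} (f : Fin b → ℕ) i → f i ≤ sum f
term≤sum f zero    = m≤m+n _ _
term≤sum f (suc i) = ≤-trans (term≤sum (f ∘ suc) i) (m≤n+m _ _)

sum-positive : ∀ {b} (f : Fin b → ℕ) → 0 < sum f → ∃ λ i → 0 < f i
sum-positive {suc b} f 0<sum with f zero in eq
... | suc _ = zero , subst (0 <_) (sym eq) (s≤s z≤n)
... | zero with sum-positive (f ∘ suc) 0<sum
...   | i , 0<fi = suc i , 0<fi

sum-pointMass : ∀ {b} (f : Fin b → ℕ) i → (∀ j → j ≢ i → f j ≡ 0) → sum f ≡ f i
sum-pointMass {suc b} f i vanish = begin
  sum f                                ≡⟨ sum-remove f ⟩
  f i + sum (λ j → f (punchIn i j))    ≡⟨ cong (f i +_) (sum-cong-≗ (λ j → vanish (punchIn i j) (punchInᵢ≢i i j))) ⟩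
  f i + sum {b} (λ _ → 0)              ≡⟨ cong (f i +_) (sum-replicate-zero b) ⟩
  f i + 0                              ≡⟨ +-identityʳ (f i) ⟩
  f i                                  ∎
  where open ≡-Reasoning

∑Maps : (a b : ℕ) → (Vec (Fin b) a → ℕ) → ℕ
∑Maps zero    b W = W []
∑Maps (suc a) b W = ∑[ i < b ] ∑Maps a b (λ t → W (i ∷ t))

module _ {b : ℕ} where

  ∑Maps-cong : ∀ a {W U : Vec (Fin b) a → ℕ} → (∀ t → W t ≡ U t) → ∑Maps a b W ≡ ∑Maps a b U
  ∑Maps-cong zero    W≗U = W≗U []
  ∑Maps-cong (suc a) W≗U = sum-cong-≗ (λ i → ∑Maps-cong a (W≗U ∘ (i ∷_)))

  ∑Maps-distrib-+ : ∀ a (W U : Vec (Fin b) a → ℕ) → ∑Maps a b (λ t → W t + U t) ≡ ∑Maps a b W + ∑Maps a b U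
  ∑Maps-distrib-+ zero    W U = refl
  ∑Maps-distrib-+ (suc a) W U =
    trans (sum-cong-≗ (λ i → ∑Maps-distrib-+ a (W ∘ (i ∷_)) (U ∘ (i ∷_))))
          (∑-distrib-+ (λ i → ∑Maps a b (W ∘ (i ∷_))) (λ i → ∑Maps a b (U ∘ (i ∷_))))

  ∑Maps-comm : ∀ a {c} (W : Fin c → Vec (Fin b) a → ℕ) →
    ∑Maps a b (λ t → ∑[ j < c ] W j t) ≡ ∑[ j < c ] ∑Maps a b (W j)
  ∑Maps-comm zero    W = refl
  ∑Maps-comm (suc a) W = trans (sum-cong-≗ (λ i → ∑Maps-comm a (λ j t → W j (i ∷ t))))
                                (∑-comm (λ i j → ∑Maps a b (λ t → W j (i ∷ t))))

  ∑Maps-insertAt : ∀ a (q : Fin (suc a)) (W : Vec (Fin b) (suc a) → ℕ) →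
    ∑Maps (suc a) b W ≡ ∑[ i < b ] ∑Maps a b (λ t → W (insertAt t q i))
  ∑Maps-insertAt a       zero    W = refl
  ∑Maps-insertAt (suc a) (suc q) W =
    trans (sum-cong-≗ (λ j → ∑Maps-insertAt a q (W ∘ (j ∷_))))
          (∑-comm (λ j i → ∑Maps a b (λ t → W (j ∷ insertAt t q i))))

  ∑Maps-++ : ∀ a₁ a₂ (W : Vec (Fin b) (a₁ + a₂) → ℕ) →
    ∑Maps (a₁ + a₂) b W ≡ ∑Maps a₁ b (λ t₁ → ∑Maps a₂ b (λ t₂ → W (t₁ ++ t₂)))
  ∑Maps-++ zero     a₂ W = refl
  ∑Maps-++ (suc a₁) a₂ W = sum-cong-≗ (λ i → ∑Maps-++ a₁ a₂ (W ∘ (i ∷_)))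

  ∑Maps-*ʳ : ∀ a c (W : Vec (Fin b) a → ℕ) → ∑Maps a b W * c ≡ ∑Maps a b (λ t → W t * c)
  ∑Maps-*ʳ zero    c W = refl
  ∑Maps-*ʳ (suc a) c W =
    trans (*-distribʳ-sum c (λ i → ∑Maps a b (W ∘ (i ∷_)))) (sum-cong-≗ (λ i → ∑Maps-*ʳ a c (W ∘ (i ∷_))))

  ∑Maps-*ˡ : ∀ a c (W : Vec (Fin b) a → ℕ) → c * ∑Maps a b W ≡ ∑Maps a b (λ t → c * W t)
  ∑Maps-*ˡ zero    c W = refl
  ∑Maps-*ˡ (suc a) c W =
    trans (*-distribˡ-sum c (λ i → ∑Maps a b (W ∘ (i ∷_)))) (sum-cong-≗ (λ i → ∑Maps-*ˡ a c (W ∘ (i ∷_))))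

  ∑Maps-product : ∀ a₁ a₂ (W₁ : Vec (Fin b) a₁ → ℕ) (W₂ : Vec (Fin b) a₂ → ℕ) →
    ∑Maps a₁ b (λ t₁ → ∑Maps a₂ b (λ t₂ → W₁ t₁ * W₂ t₂)) ≡ ∑Maps a₁ b W₁ * ∑Maps a₂ b W₂
  ∑Maps-product a₁ a₂ W₁ W₂ =
    trans (∑Maps-cong a₁ (λ t₁ → sym (∑Maps-*ˡ a₂ (W₁ t₁) W₂))) (sym (∑Maps-*ʳ a₁ (∑Maps a₂ b W₂) W₁))

  term≤∑Maps : ∀ a (W : Vec (Fin b) a → ℕ) t → W t ≤ ∑Maps a b W
  term≤∑Maps zero    W []      = ≤-refl
  term≤∑Maps (suc a) W (i ∷ t) = ≤-trans (term≤∑Maps a (W ∘ (i ∷_)) t) (term≤sum _ i)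

  ∑Maps-positive : ∀ a (W : Vec (Fin b) a → ℕ) → 0 < ∑Maps a b W → ∃ λ t → 0 < W t
  ∑Maps-positive zero    W 0<W = [] , 0<W
  ∑Maps-positive (suc a) W 0<∑ with sum-positive _ 0<∑
  ... | i , 0<Wi with ∑Maps-positive a _ 0<Wi
  ...   | t , 0<Wt = i ∷ t , 0<Wt

sum-map-allMaps : ∀ a b (W : Vec (Fin b) a → ℕ) → listSum (List.map W (allMaps a b)) ≡ ∑Maps a b W
sum-map-allMaps zero    b W = +-identityʳ (W [])
sum-map-allMaps (suc a) b W = go b id
  where
  go : ∀ c (g : Fin c → Fin b) →
    listSum (List.map W (concatMap (λ i → List.map (i ∷_) (allMaps a b)) (List.tabulate g))) ≡
    ∑[ j < c ] ∑Maps a b (λ t → W (g j ∷ t))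
  go zero    g = refl
  go (suc c) g = begin
    listSum (List.map W (List.map (g zero ∷_) (allMaps a b) List.++ rest))
      ≡⟨ cong listSum (List.map-++ W (List.map (g zero ∷_) (allMaps a b)) rest) ⟩
    listSum (List.map W (List.map (g zero ∷_) (allMaps a b)) List.++ List.map W rest)
      ≡⟨ listSum-++ (List.map W (List.map (g zero ∷_) (allMaps a b))) (List.map W rest) ⟩
    listSum (List.map W (List.map (g zero ∷_) (allMaps a b))) + listSum (List.map W rest)
      ≡⟨ cong₂ _+_ (trans (cong listSum (sym (List.map-∘ (allMaps a b)))) (sum-map-allMaps a b _)) (go c (g ∘ suc)) ⟩
    ∑[ j < suc c ] ∑Maps a b (λ t → W (g j ∷ t)) ∎
    where
    open ≡-Reasoning
    rest : List (Vec (Fin b) (suc a))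
    rest = concatMap (λ i → List.map (i ∷_) (allMaps a b)) (List.tabulate (g ∘ suc))

length-filter-𝟙 : ∀ {A : Set} {P : Pred A 0ℓ} (P? : Decidable P) xs →
  length (filter P? xs) ≡ listSum (List.map (𝟙 ∘ P?) xs)
length-filter-𝟙 P? []       = refl
length-filter-𝟙 P? (x ∷ xs) with P? x
... | yes _ = cong suc (length-filter-𝟙 P? xs)
... | no _  = length-filter-𝟙 P? xs

countMaps : (a b : ℕ) {P : Pred (Vec (Fin b) a) 0ℓ} → Decidable P → ℕ
countMaps a b P? = ∑Maps a b (𝟙 ∘ P?)

homCount-countMaps : ∀ G v H w → homCount G v H w ≡ countMaps (n G) (n H) (isRootedHom? G v H w)
homCount-countMaps G v H w =
  trans (length-filter-𝟙 (isRootedHom? G v H w) (allMaps (n G) (n H))) (sum-map-allMaps (n G) (n H) _)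

module _ {a b : ℕ} where

  countMaps-⇔ : {P Q : Pred (Vec (Fin b) a) 0ℓ} (P? : Decidable P) (Q? : Decidable Q) →
    (∀ t → P t ⇔ Q t) → countMaps a b P? ≡ countMaps a b Q?
  countMaps-⇔ P? Q? P⇔Q = ∑Maps-cong a (λ t → 𝟙-⇔ (P? t) (Q? t) (P⇔Q t))

  countMaps-split : {P Q : Pred (Vec (Fin b) a) 0ℓ} (P? : Decidable P) (Q? : Decidable Q) →
    countMaps a b P? ≡ countMaps a b (λ t → P? t ×-dec ¬? (Q? t)) + countMaps a b (λ t → P? t ×-dec Q? t)
  countMaps-split P? Q? = trans (∑Maps-cong a split) (∑Maps-distrib-+ a _ _)
    where
    split : ∀ t → 𝟙 (P? t) ≡ 𝟙 (P? t ×-dec ¬? (Q? t)) + 𝟙 (P? t ×-dec Q? t)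
    split t = begin
      𝟙 (P? t)                                   ≡⟨ sym (*-identityʳ _) ⟩
      𝟙 (P? t) * 1                               ≡⟨ cong (𝟙 (P? t) *_) (sym (𝟙-complement (Q? t))) ⟩
      𝟙 (P? t) * (𝟙 (¬? (Q? t)) + 𝟙 (Q? t))      ≡⟨ *-distribˡ-+ (𝟙 (P? t)) _ _ ⟩
      𝟙 (P? t) * 𝟙 (¬? (Q? t)) + 𝟙 (P? t) * 𝟙 (Q? t)
        ≡⟨ sym (cong₂ _+_ (𝟙-× (P? t) (¬? (Q? t))) (𝟙-× (P? t) (Q? t))) ⟩
      𝟙 (P? t ×-dec ¬? (Q? t)) + 𝟙 (P? t ×-dec Q? t) ∎
      where open ≡-Reasoning

  countMaps-positive : {P : Pred (Vec (Fin b) a) 0ℓ} (P? : Decidable P) → 0 < countMaps a b P? → ∃ P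
  countMaps-positive P? 0<count with ∑Maps-positive a _ 0<count
  ... | t , 0<𝟙 = t , 𝟙-positive (P? t) 0<𝟙

  countMaps-empty : {P : Pred (Vec (Fin b) a) 0ℓ} (P? : Decidable P) → (∀ t → ¬ P t) → countMaps a b P? ≡ 0
  countMaps-empty P? ¬P = n≤0⇒n≡0 (≮⇒≥ λ 0<count → ¬P _ (proj₂ (countMaps-positive P? 0<count)))

  countMaps-witness : {P : Pred (Vec (Fin b) a) 0ℓ} (P? : Decidable P) → ∀ t → P t → 0 < countMaps a b P?
  countMaps-witness P? t Pt =
    ≤-trans (≤-reflexive (sym (𝟙-yes (P? t) Pt))) (term≤∑Maps a (𝟙 ∘ P?) t)

-- collapse identifies q with p and renumbers the other points in order; expand t is t ∘ collapse.
collapse : ∀ {a} {q p : Fin a} → q ≢ p → Fin a → Fin (pred a)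
collapse {suc _} {q} q≢p z with q Fin.≟ z
... | yes _   = punchOut q≢p
... | no q≢z  = punchOut q≢z

expand : ∀ {a b} {q p : Fin a} → q ≢ p → Vec (Fin b) (pred a) → Vec (Fin b) a
expand {suc _} {q = q} q≢p t = insertAt t q (lookup t (punchOut q≢p))

lookup-expand : ∀ {a b} {q p : Fin a} (q≢p : q ≢ p) (t : Vec (Fin b) (pred a)) z →
  lookup (expand q≢p t) z ≡ lookup t (collapse q≢p z)
lookup-expand {suc _} {q = q} q≢p t z with q Fin.≟ z
... | yes refl = insertAt-lookup t q _
... | no q≢z   =
    trans (cong (lookup (insertAt t q _)) (sym (punchIn-punchOut q≢z))) (insertAt-punchIn t q _ (punchOut q≢z))

collapse-surjective : ∀ {a} {q p : Fin a} (q≢p : q ≢ p) y → ∃ λ z → collapse q≢p z ≡ y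
collapse-surjective {suc _} {q} q≢p y = punchIn q y , collapse-punchIn
  where
  collapse-punchIn : collapse q≢p (punchIn q y) ≡ y
  collapse-punchIn with q Fin.≟ punchIn q y
  ... | yes q≡ = ⊥-elim (punchInᵢ≢i q y (sym q≡))
  ... | no _   = trans (punchOut-cong q refl) (punchOut-punchIn q)

collapse-identifies : ∀ {a} {q p : Fin a} (q≢p : q ≢ p) → collapse q≢p q ≡ collapse q≢p p
collapse-identifies {suc _} {q} {p} q≢p with q Fin.≟ q | q Fin.≟ p
... | no q≢q | _       = ⊥-elim (q≢q refl)
... | yes _  | yes q≡p = ⊥-elim (q≢p q≡p)
... | yes _  | no _    = punchOut-cong q refl

collapse-fibres : ∀ {a} {q p : Fin a} (q≢p : q ≢ p) {z z′} → collapse q≢p z ≡ collapse q≢p z′ →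
  z ≡ z′ ⊎ (z ≡ q × z′ ≡ p) ⊎ (z ≡ p × z′ ≡ q)
collapse-fibres {suc _} {q} q≢p {z} {z′} eq with q Fin.≟ z | q Fin.≟ z′
... | yes refl | yes refl = inj₁ refl
... | yes refl | no q≢z′  = inj₂ (inj₁ (refl , sym (punchOut-injective q≢p q≢z′ eq)))
... | no q≢z   | yes refl = inj₂ (inj₂ (punchOut-injective q≢z q≢p eq , refl))
... | no q≢z   | no q≢z′  = inj₁ (punchOut-injective q≢z q≢z′ eq)

countMaps-identify : ∀ {a b} {q p : Fin a} (q≢p : q ≢ p) {P : Pred (Vec (Fin b) a) 0ℓ} (P? : Decidable P) →
  countMaps a b (λ h → P? h ×-dec (lookup h p Fin.≟ lookup h q)) ≡ countMaps (pred a) b (P? ∘ expand q≢p)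
countMaps-identify {suc m} {b} {q} {p} q≢p {P} P? = begin
  ∑Maps (suc m) b (λ h → 𝟙 (P? h ×-dec (lookup h p Fin.≟ lookup h q)))
    ≡⟨ ∑Maps-insertAt m q (λ h → 𝟙 (P? h ×-dec (lookup h p Fin.≟ lookup h q))) ⟩
  ∑[ i < b ] ∑Maps m b (λ t → 𝟙 (P? (ins t i) ×-dec (lookup (ins t i) p Fin.≟ lookup (ins t i) q)))
    ≡⟨ sum-cong-≗ (λ i → ∑Maps-cong m (λ t → 𝟙-⇔ _ _ (agreement t i))) ⟩
  ∑[ i < b ] ∑Maps m b (λ t → 𝟙 (P? (ins t i) ×-dec (lookup t p′ Fin.≟ i)))
    ≡⟨ sym (∑Maps-comm m (λ i t → 𝟙 (P? (ins t i) ×-dec (lookup t p′ Fin.≟ i)))) ⟩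
  ∑Maps m b (λ t → ∑[ i < b ] 𝟙 (P? (ins t i) ×-dec (lookup t p′ Fin.≟ i)))
    ≡⟨ ∑Maps-cong m concentrate ⟩
  ∑Maps m b (λ t → 𝟙 (P? (ins t (lookup t p′)))) ∎
  where
  open ≡-Reasoning
  p′ : Fin m
  p′ = punchOut q≢p
  ins : Vec (Fin b) m → Fin b → Vec (Fin b) (suc m)
  ins t i = insertAt t q i
  lookup-p : ∀ t i → lookup (ins t i) p ≡ lookup t p′
  lookup-p t i = trans (cong (lookup (ins t i)) (sym (punchIn-punchOut q≢p))) (insertAt-punchIn t q i p′)
  agreement : ∀ t i → (P (ins t i) × lookup (ins t i) p ≡ lookup (ins t i) q) ⇔ (P (ins t i) × lookup t p′ ≡ i)
  agreement t i = mk⇔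
    (λ (Pt , e) → Pt , trans (sym (lookup-p t i)) (trans e (insertAt-lookup t q i)))
    (λ (Pt , e) → Pt , trans (lookup-p t i) (trans e (sym (insertAt-lookup t q i))))
  concentrate : ∀ t → ∑[ i < b ] 𝟙 (P? (ins t i) ×-dec (lookup t p′ Fin.≟ i)) ≡ 𝟙 (P? (ins t (lookup t p′)))
  concentrate t =
    trans (sum-pointMass (λ i → 𝟙 (P? (ins t i) ×-dec (lookup t p′ Fin.≟ i))) (lookup t p′)
            (λ j j≢c → 𝟙-no (P? (ins t j) ×-dec (lookup t p′ Fin.≟ j)) (λ (_ , c≡j) → j≢c (sym c≡j))))
          (𝟙-⇔ _ _ (mk⇔ proj₁ (_, refl)))

countMaps-++ : ∀ {a₁ a₂ b} {P : Pred (Vec (Fin b) (a₁ + a₂)) 0ℓ}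
  {Q₁ : Pred (Vec (Fin b) a₁) 0ℓ} {Q₂ : Pred (Vec (Fin b) a₂) 0ℓ}
  (P? : Decidable P) (Q₁? : Decidable Q₁) (Q₂? : Decidable Q₂) → (∀ t₁ t₂ → P (t₁ ++ t₂) ⇔ (Q₁ t₁ × Q₂ t₂)) →
  countMaps (a₁ + a₂) b P? ≡ countMaps a₁ b Q₁? * countMaps a₂ b Q₂?
countMaps-++ {a₁} {a₂} {b} P? Q₁? Q₂? splits = begin
  ∑Maps (a₁ + a₂) b (𝟙 ∘ P?)                                     ≡⟨ ∑Maps-++ a₁ a₂ (𝟙 ∘ P?) ⟩
  ∑Maps a₁ b (λ t₁ → ∑Maps a₂ b (λ t₂ → 𝟙 (P? (t₁ ++ t₂))))
    ≡⟨ ∑Maps-cong a₁ (λ t₁ → ∑Maps-cong a₂ (λ t₂ →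
         trans (𝟙-⇔ (P? (t₁ ++ t₂)) (Q₁? t₁ ×-dec Q₂? t₂) (splits t₁ t₂)) (𝟙-× (Q₁? t₁) (Q₂? t₂)))) ⟩
  ∑Maps a₁ b (λ t₁ → ∑Maps a₂ b (λ t₂ → 𝟙 (Q₁? t₁) * 𝟙 (Q₂? t₂))) ≡⟨ ∑Maps-product a₁ a₂ (𝟙 ∘ Q₁?) (𝟙 ∘ Q₂?) ⟩
  ∑Maps a₁ b (𝟙 ∘ Q₁?) * ∑Maps a₂ b (𝟙 ∘ Q₂?)                    ∎
  where open ≡-Reasoning

-- Graph constructions

IsHom : (F H : Graph) → Vec (Fin (n H)) (n F) → Set
IsHom F H h = ∀ x y → Edge F x y → Edge H (lookup h x) (lookup h y)

edge? : ∀ G x y → Dec (Edge G x y)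
edge? G x y = adj G x y Bool.≟ true

does≡true⇔ : ∀ {A : Set} (a? : Dec A) → does a? ≡ true ⇔ A
does≡true⇔ (yes a) = mk⇔ (λ _ → a) (λ _ → refl)
does≡true⇔ (no ¬a) = mk⇔ (λ ()) (⊥-elim ∘ ¬a)

fromRelation : (m : ℕ) (R : Fin m → Fin m → Set) → (∀ x y → Dec (R x y)) → (∀ {x y} → R x y → R y x) → Graph
fromRelation m R R? R-sym = record
  { n = m ; adj = λ x y → does (R? x y) ; adj-sym = λ x y → does-⇔ (mk⇔ R-sym R-sym) (R? x y) (R? y x) }

Proper : (G : Graph) → (Vertex G → Bool) → Set
Proper G c = ∀ x y → Edge G x y → c x ≢ c y

edge-sym : ∀ G {x y} → Edge G x y → Edge G y x
edge-sym G {x} {y} e = trans (adj-sym G y x) e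

irreflexive⇒¬loop : ∀ G → Irreflexive G → ∀ x → ¬ Edge G x x
irreflexive⇒¬loop G irr x e with trans (sym e) (irr x)
... | ()

¬loop⇒irreflexive : ∀ G → (∀ x → ¬ Edge G x x) → Irreflexive G
¬loop⇒irreflexive G ¬loop x with adj G x x in e
... | false = refl
... | true  = ⊥-elim (¬loop x e)

Reach-trans : ∀ {G x y z} → Reach G x y → Reach G y z → Reach G x z
Reach-trans here        r′ = r′
Reach-trans (step e r)  r′ = step e (Reach-trans r r′)

Reach-sym : ∀ {G x y} → Reach G x y → Reach G y x
Reach-sym here                 = here
Reach-sym {G} (step e r) = Reach-trans (Reach-sym r) (step (edge-sym G e) here)

Reach-map : ∀ {F G} (f : Vertex F → Vertex G) → (∀ {x y} → Edge F x y → Edge G (f x) (f y)) →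
  ∀ {x y} → Reach F x y → Reach G (f x) (f y)
Reach-map f hom here       = here
Reach-map f hom (step e r) = step (hom e) (Reach-map f hom r)

QuotientEdge : (F : Graph) {m : ℕ} → (Vertex F → Fin m) → Fin m → Fin m → Set
QuotientEdge F g a b = ∃ λ z → ∃ λ z′ → (g z ≡ a × g z′ ≡ b) × Edge F z z′

quotientEdge? : (F : Graph) {m : ℕ} (g : Vertex F → Fin m) → ∀ a b → Dec (QuotientEdge F g a b)
quotientEdge? F g a b = any? λ z → any? λ z′ → (g z Fin.≟ a ×-dec g z′ Fin.≟ b) ×-dec edge? F z z′

Quotient : (F : Graph) (m : ℕ) → (Vertex F → Fin m) → Graph
Quotient F m g = fromRelation m (QuotientEdge F g) (quotientEdge? F g)
  (λ (z , z′ , (gz , gz′) , e) → z′ , z , (gz′ , gz) , edge-sym F e)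

quotient-edge⇔ : ∀ F {m} (g : Vertex F → Fin m) {a b} → Edge (Quotient F m g) a b ⇔ QuotientEdge F g a b
quotient-edge⇔ F g {a} {b} = does≡true⇔ (quotientEdge? F g a b)

merge : (F : Graph) {q p : Vertex F} → q ≢ p → Graph
merge F q≢p = Quotient F (pred (n F)) (collapse q≢p)

AddedEdge : (F : Graph) → Vertex F → Vertex F → Vertex F → Vertex F → Set
AddedEdge F p q x y = Edge F x y ⊎ (x ≡ p × y ≡ q) ⊎ (x ≡ q × y ≡ p)

addedEdge? : ∀ F p q x y → Dec (AddedEdge F p q x y)
addedEdge? F p q x y = edge? F x y ⊎-dec (x Fin.≟ p ×-dec y Fin.≟ q) ⊎-dec (x Fin.≟ q ×-dec y Fin.≟ p)

addEdge : (F : Graph) → Vertex F → Vertex F → Graph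
addEdge F p q = fromRelation (n F) (AddedEdge F p q) (addedEdge? F p q)
  λ { (inj₁ e) → inj₁ (edge-sym F e) ; (inj₂ (inj₁ (x≡p , y≡q))) → inj₂ (inj₂ (y≡q , x≡p))
    ; (inj₂ (inj₂ (x≡q , y≡p))) → inj₂ (inj₁ (y≡p , x≡q)) }

addEdge-edge⇔ : ∀ F p q {x y} → Edge (addEdge F p q) x y ⇔ AddedEdge F p q x y
addEdge-edge⇔ F p q {x} {y} = does≡true⇔ (addedEdge? F p q x y)

looplessEdge? : ∀ F x y → Dec (Edge F x y × x ≢ y)
looplessEdge? F x y = edge? F x y ×-dec ¬? (x Fin.≟ y)

loopless : Graph → Graph
loopless F = fromRelation (n F) (λ x y → Edge F x y × x ≢ y) (looplessEdge? F)
  (λ (e , x≢y) → edge-sym F e , x≢y ∘ sym)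

loopless-edge⇔ : ∀ F {x y} → Edge (loopless F) x y ⇔ (Edge F x y × x ≢ y)
loopless-edge⇔ F {x} {y} = does≡true⇔ (looplessEdge? F x y)

loopless-edge-≢ : ∀ F {x y} → x ≢ y → Edge (loopless F) x y ⇔ Edge F x y
loopless-edge-≢ F x≢y =
  mk⇔ (proj₁ ∘ Equivalence.to (loopless-edge⇔ F)) (λ e → Equivalence.from (loopless-edge⇔ F) (e , x≢y))

module _ (G₁ G₂ : Graph) where

  sumAdj : Vertex G₁ ⊎ Vertex G₂ → Vertex G₁ ⊎ Vertex G₂ → Bool
  sumAdj (inj₁ a) (inj₁ b) = adj G₁ a b
  sumAdj (inj₂ a) (inj₂ b) = adj G₂ a b
  sumAdj (inj₁ _) (inj₂ _) = false
  sumAdj (inj₂ _) (inj₁ _) = false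

  sumAdj-sym : ∀ s t → sumAdj s t ≡ sumAdj t s
  sumAdj-sym (inj₁ a) (inj₁ b) = adj-sym G₁ a b
  sumAdj-sym (inj₂ a) (inj₂ b) = adj-sym G₂ a b
  sumAdj-sym (inj₁ _) (inj₂ _) = refl
  sumAdj-sym (inj₂ _) (inj₁ _) = refl

_⊕_ : Graph → Graph → Graph
G₁ ⊕ G₂ = record
  { n = n G₁ + n G₂
  ; adj = λ x y → sumAdj G₁ G₂ (splitAt (n G₁) x) (splitAt (n G₁) y)
  ; adj-sym = λ x y → sumAdj-sym G₁ G₂ (splitAt (n G₁) x) (splitAt (n G₁) y) }

module _ (F : Graph) {m : ℕ} (g : Vertex F → Fin m) where

  quotient-edge : ∀ {z z′} → Edge F z z′ → Edge (Quotient F m g) (g z) (g z′)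
  quotient-edge e = Equivalence.from (quotient-edge⇔ F g) (_ , _ , (refl , refl) , e)

  quotient-connected : (∀ a → ∃ λ z → g z ≡ a) → Connected F → Connected (Quotient F m g)
  quotient-connected surj conn a b with surj a | surj b
  ... | z , refl | z′ , refl = Reach-map g quotient-edge (conn z z′)

  quotient-hasEdge : HasEdge F → HasEdge (Quotient F m g)
  quotient-hasEdge (x , y , e) = g x , g y , quotient-edge e

module _ (F : Graph) {q p : Vertex F} (q≢p : q ≢ p) where

  merge-connected : (∀ x → Reach F x p ⊎ Reach F x q) → Connected (merge F q≢p)
  merge-connected reaches a b with collapse-surjective q≢p a | collapse-surjective q≢p b
  ... | z , refl | z′ , refl = Reach-trans (toCentre z) (Reach-sym (toCentre z′))
    where
    toCentre : ∀ z → Reach (merge F q≢p) (collapse q≢p z) (collapse q≢p p)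
    toCentre z with reaches z
    ... | inj₁ r = Reach-map (collapse q≢p) (quotient-edge F (collapse q≢p)) r
    ... | inj₂ r = subst (Reach (merge F q≢p) (collapse q≢p z)) (collapse-identifies q≢p)
                     (Reach-map (collapse q≢p) (quotient-edge F (collapse q≢p)) r)

  merge-irreflexive : Irreflexive F → ¬ Edge F q p → Irreflexive (merge F q≢p)
  merge-irreflexive irr ¬qp = ¬loop⇒irreflexive (merge F q≢p) ¬loop
    where
    ¬loop : ∀ a → ¬ Edge (merge F q≢p) a a
    ¬loop a loop with Equivalence.to (quotient-edge⇔ F (collapse q≢p)) loop
    ... | z , z′ , (za , z′a) , e with collapse-fibres q≢p (trans za (sym z′a))
    ...   | inj₁ refl               = irreflexive⇒¬loop F irr z e
    ...   | inj₂ (inj₁ (refl , refl)) = ¬qp e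
    ...   | inj₂ (inj₂ (refl , refl)) = ¬qp (edge-sym F e)

  merge-bipartite : (c : Vertex F → Bool) → Proper F c → c q ≡ c p → Bipartite (merge F q≢p)
  merge-bipartite c proper cq≡cp = c ∘ section , proper′
    where
    section : Vertex (merge F q≢p) → Vertex F
    section a = proj₁ (collapse-surjective q≢p a)
    constant-on-fibres : ∀ {z z′} → collapse q≢p z ≡ collapse q≢p z′ → c z ≡ c z′
    constant-on-fibres eq with collapse-fibres q≢p eq
    ... | inj₁ refl                   = refl
    ... | inj₂ (inj₁ (refl , refl)) = cq≡cp
    ... | inj₂ (inj₂ (refl , refl)) = sym cq≡cp
    section-colour : ∀ {a z} → collapse q≢p z ≡ a → c (section a) ≡ c z
    section-colour {a} za = constant-on-fibres (trans (proj₂ (collapse-surjective q≢p a)) (sym za))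
    proper′ : Proper (merge F q≢p) (c ∘ section)
    proper′ a b e with Equivalence.to (quotient-edge⇔ F (collapse q≢p)) e
    ... | z , z′ , (za , z′b) , e′ = λ same → proper z z′ e′
            (trans (sym (section-colour za)) (trans same (section-colour z′b)))

addEdge-connected : ∀ F p q → Connected F → Connected (addEdge F p q)
addEdge-connected F p q conn x y = Reach-map id (Equivalence.from (addEdge-edge⇔ F p q) ∘ inj₁) (conn x y)

addEdge-hasEdge : ∀ F p q → HasEdge F → HasEdge (addEdge F p q)
addEdge-hasEdge F p q (x , y , e) = x , y , Equivalence.from (addEdge-edge⇔ F p q) (inj₁ e)

loopless-irreflexive : ∀ F → Irreflexive (loopless F)
loopless-irreflexive F = ¬loop⇒irreflexive (loopless F) λ x e → proj₂ (Equivalence.to (loopless-edge⇔ F) e) refl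

loopless-connected : ∀ F → Connected F → Connected (loopless F)
loopless-connected F conn x y = dropLoops (conn x y)
  where
  dropLoops : ∀ {x y} → Reach F x y → Reach (loopless F) x y
  dropLoops here = here
  dropLoops (step {x} {y} e r) with x Fin.≟ y
  ... | yes refl = dropLoops r
  ... | no x≢y   = step (Equivalence.from (loopless-edge⇔ F) (e , x≢y)) (dropLoops r)

module _ (G₁ G₂ : Graph) where
  private
    n₁ n₂ : ℕ
    n₁ = n G₁
    n₂ = n G₂

  ⊕-edgeˡ : ∀ {a b} → Edge G₁ a b → Edge (G₁ ⊕ G₂) (a ↑ˡ n₂) (b ↑ˡ n₂)
  ⊕-edgeˡ {a} {b} e rewrite splitAt-↑ˡ n₁ a n₂ | splitAt-↑ˡ n₁ b n₂ = e

  ⊕-edgeʳ : ∀ {a b} → Edge G₂ a b → Edge (G₁ ⊕ G₂) (n₁ ↑ʳ a) (n₁ ↑ʳ b)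
  ⊕-edgeʳ {a} {b} e rewrite splitAt-↑ʳ n₁ n₂ a | splitAt-↑ʳ n₁ n₂ b = e

  ⊕-¬edge : ∀ a b → ¬ Edge (G₁ ⊕ G₂) (n₁ ↑ʳ b) (a ↑ˡ n₂)
  ⊕-¬edge a b e rewrite splitAt-↑ˡ n₁ a n₂ | splitAt-↑ʳ n₁ n₂ b with e
  ... | ()

  ⊕-edge-cases : ∀ x y → Edge (G₁ ⊕ G₂) x y →
    (∃ λ a → ∃ λ b → x ≡ a ↑ˡ n₂ × y ≡ b ↑ˡ n₂ × Edge G₁ a b) ⊎
    (∃ λ a → ∃ λ b → x ≡ n₁ ↑ʳ a × y ≡ n₁ ↑ʳ b × Edge G₂ a b)
  ⊕-edge-cases x y e with splitAt n₁ x in sx | splitAt n₁ y in sy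
  ... | inj₁ a | inj₁ b = inj₁ (a , b , sym (splitAt⁻¹-↑ˡ sx) , sym (splitAt⁻¹-↑ˡ sy) , e)
  ... | inj₂ a | inj₂ b = inj₂ (a , b , sym (splitAt⁻¹-↑ʳ sx) , sym (splitAt⁻¹-↑ʳ sy) , e)

  ⊕-irreflexive : Irreflexive G₁ → Irreflexive G₂ → Irreflexive (G₁ ⊕ G₂)
  ⊕-irreflexive irr₁ irr₂ x with splitAt n₁ x
  ... | inj₁ a = irr₁ a
  ... | inj₂ b = irr₂ b

  ⊕-reach : Connected G₁ → Connected G₂ → ∀ v₁ v₂ x → Reach (G₁ ⊕ G₂) x (v₁ ↑ˡ n₂) ⊎ Reach (G₁ ⊕ G₂) x (n₁ ↑ʳ v₂)
  ⊕-reach conn₁ conn₂ v₁ v₂ x with splitAt n₁ x in sx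
  ... | inj₁ a = inj₁ (subst (λ z → Reach (G₁ ⊕ G₂) z (v₁ ↑ˡ n₂)) (splitAt⁻¹-↑ˡ sx)
                         (Reach-map (_↑ˡ n₂) ⊕-edgeˡ (conn₁ a v₁)))
  ... | inj₂ b = inj₂ (subst (λ z → Reach (G₁ ⊕ G₂) z (n₁ ↑ʳ v₂)) (splitAt⁻¹-↑ʳ sx)
                         (Reach-map (n₁ ↑ʳ_) ⊕-edgeʳ (conn₂ b v₂)))

  ⊕-bipartite : ∀ c₁ c₂ → Proper G₁ c₁ → Proper G₂ c₂ → Proper (G₁ ⊕ G₂) ([ c₁ , c₂ ]′ ∘ splitAt n₁)
  ⊕-bipartite c₁ c₂ proper₁ proper₂ x y e with ⊕-edge-cases x y e
  ... | inj₁ (a , b , refl , refl , e′) rewrite splitAt-↑ˡ n₁ a n₂ | splitAt-↑ˡ n₁ b n₂ = proper₁ a b e′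
  ... | inj₂ (a , b , refl , refl , e′) rewrite splitAt-↑ʳ n₁ n₂ a | splitAt-↑ʳ n₁ n₂ b = proper₂ a b e′

module _ (F : Graph) (v : Vertex F) (H : Graph) (w : Vertex H) where

  isRootedHom-quotient : ∀ {m} (g : Vertex F → Fin m) h t → (∀ z → lookup h z ≡ lookup t (g z)) →
    IsRootedHom F v H w h ⇔ IsRootedHom (Quotient F m g) (g v) H w t
  isRootedHom-quotient g h t h≗t∘g = mk⇔
    (λ (hom , root) → (λ a b e → descend a b (Equivalence.to (quotient-edge⇔ F g) e) hom) ,
                       trans (sym (h≗t∘g v)) root)
    (λ (hom , root) → (λ x y e → subst₂ (Edge H) (sym (h≗t∘g x)) (sym (h≗t∘g y))
                                        (hom (g x) (g y) (quotient-edge F g {x} {y} e))) ,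
                       trans (h≗t∘g v) root)
    where
    descend : ∀ a b → QuotientEdge F g a b → IsHom F H h →
      Edge H (lookup t a) (lookup t b)
    descend _ _ (z , z′ , (refl , refl) , e) hom = subst₂ (Edge H) (h≗t∘g z) (h≗t∘g z′) (hom z z′ e)

  isRootedHom-merge : ∀ {q p} (q≢p : q ≢ p) t →
    IsRootedHom F v H w (expand q≢p t) ⇔ IsRootedHom (merge F q≢p) (collapse q≢p v) H w t
  isRootedHom-merge q≢p t = isRootedHom-quotient (collapse q≢p) (expand q≢p t) t (lookup-expand q≢p t)

  isRootedHom-addEdge : ∀ p q h →
    IsRootedHom (addEdge F p q) v H w h ⇔ (IsRootedHom F v H w h × Edge H (lookup h p) (lookup h q))
  isRootedHom-addEdge p q h = mk⇔
    (λ (hom , root) → ((λ x y e → hom x y (added (inj₁ e))) , root) , hom p q (added (inj₂ (inj₁ (refl , refl)))))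
    (λ ((hom , root) , e) → (λ x y e′ → extend hom e x y (Equivalence.to (addEdge-edge⇔ F p q) e′)) , root)
    where
    added : ∀ {x y} → AddedEdge F p q x y → Edge (addEdge F p q) x y
    added = Equivalence.from (addEdge-edge⇔ F p q)
    extend : IsHom F H h → Edge H (lookup h p) (lookup h q) →
      ∀ x y → AddedEdge F p q x y → Edge H (lookup h x) (lookup h y)
    extend hom e x y (inj₁ e′)                  = hom x y e′
    extend hom e x y (inj₂ (inj₁ (refl , refl))) = e
    extend hom e x y (inj₂ (inj₂ (refl , refl))) = edge-sym H e

  isRootedHom-loopless : Reflexive H → ∀ h → IsRootedHom (loopless F) v H w h ⇔ IsRootedHom F v H w h
  isRootedHom-loopless refl-H h = mk⇔
    (λ (hom , root) → (λ x y e → restore hom x y e) , root)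
    (λ (hom , root) → (λ x y e → hom x y (proj₁ (Equivalence.to (loopless-edge⇔ F) e))) , root)
    where
    restore : IsHom (loopless F) H h → IsHom F H h
    restore hom x y e with x Fin.≟ y
    ... | yes refl = refl-H (lookup h x)
    ... | no x≢y   = hom x y (Equivalence.from (loopless-edge-≢ F x≢y) e)

module _ (G₁ : Graph) (v₁ : Vertex G₁) (G₂ : Graph) (v₂ : Vertex G₂) (H : Graph) (w : Vertex H) where
  private
    n₁ n₂ : ℕ
    n₁ = n G₁
    n₂ = n G₂

  isRootedHom-⊕ : ∀ t₁ t₂ →
    (IsRootedHom (G₁ ⊕ G₂) (v₁ ↑ˡ n₂) H w (t₁ ++ t₂) × lookup (t₁ ++ t₂) (v₁ ↑ˡ n₂) ≡ lookup (t₁ ++ t₂) (n₁ ↑ʳ v₂))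
    ⇔ (IsRootedHom G₁ v₁ H w t₁ × IsRootedHom G₂ v₂ H w t₂)
  isRootedHom-⊕ t₁ t₂ = mk⇔
    (λ ((hom , root) , roots) →
      ((λ a b e → subst₂ (Edge H) (lookup-++ˡ t₁ t₂ a) (lookup-++ˡ t₁ t₂ b) (hom _ _ (⊕-edgeˡ G₁ G₂ e))) ,
       trans (sym (lookup-++ˡ t₁ t₂ v₁)) root) ,
      ((λ a b e → subst₂ (Edge H) (lookup-++ʳ t₁ t₂ a) (lookup-++ʳ t₁ t₂ b) (hom _ _ (⊕-edgeʳ G₁ G₂ e))) ,
       trans (sym (lookup-++ʳ t₁ t₂ v₂)) (trans (sym roots) root)))
    (λ ((hom₁ , root₁) , (hom₂ , root₂)) →
      ((λ x y e → combine hom₁ hom₂ x y (⊕-edge-cases G₁ G₂ x y e)) , trans (lookup-++ˡ t₁ t₂ v₁) root₁) ,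
      trans (lookup-++ˡ t₁ t₂ v₁) (trans root₁ (sym (trans (lookup-++ʳ t₁ t₂ v₂) root₂))))
    where
    combine : IsHom G₁ H t₁ → IsHom G₂ H t₂ → ∀ x y →
      (∃ λ a → ∃ λ b → x ≡ a ↑ˡ n₂ × y ≡ b ↑ˡ n₂ × Edge G₁ a b) ⊎
      (∃ λ a → ∃ λ b → x ≡ n₁ ↑ʳ a × y ≡ n₁ ↑ʳ b × Edge G₂ a b) →
      Edge H (lookup (t₁ ++ t₂) x) (lookup (t₁ ++ t₂) y)
    combine hom₁ hom₂ _ _ (inj₁ (a , b , refl , refl , e)) =
      subst₂ (Edge H) (sym (lookup-++ˡ t₁ t₂ a)) (sym (lookup-++ˡ t₁ t₂ b)) (hom₁ a b e)
    combine hom₁ hom₂ _ _ (inj₂ (a , b , refl , refl , e)) =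
      subst₂ (Edge H) (sym (lookup-++ʳ t₁ t₂ a)) (sym (lookup-++ʳ t₁ t₂ b)) (hom₂ a b e)

-- Gluing at the root

recolour : ∀ G (c : Vertex G → Bool) → Proper G c → ∀ v b → Σ (Vertex G → Bool) λ c′ → Proper G c′ × c′ v ≡ b
recolour G c proper v b with c v Bool.≟ b
... | yes cv≡b = c , proper , cv≡b
... | no cv≢b  = not ∘ c , (λ x y e → proper x y e ∘ not-injective) , sym (¬-not (cv≢b ∘ sym))

module _ (G₁ : Graph) (v₁ : Vertex G₁) (G₂ : Graph) (v₂ : Vertex G₂) where
  private
    n₁ n₂ : ℕ
    n₁ = n G₁
    n₂ = n G₂
    left right : Vertex (G₁ ⊕ G₂)
    left  = v₁ ↑ˡ n₂
    right = n₁ ↑ʳ v₂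

  roots-distinct : right ≢ left
  roots-distinct eq with trans (sym (splitAt-↑ʳ n₁ n₂ v₂)) (trans (cong (splitAt n₁) eq) (splitAt-↑ˡ n₁ v₁ n₂))
  ... | ()

  glue : Graph
  glue = merge (G₁ ⊕ G₂) roots-distinct

  glueRoot : Vertex glue
  glueRoot = collapse roots-distinct left

  glue-homCount : ∀ H w → homCount glue glueRoot H w ≡ homCount G₁ v₁ H w * homCount G₂ v₂ H w
  glue-homCount H w = begin
    homCount glue glueRoot H w
      ≡⟨ homCount-countMaps glue glueRoot H w ⟩
    countMaps (pred (n₁ + n₂)) (n H) (isRootedHom? glue glueRoot H w)
      ≡⟨ countMaps-⇔ _ _ (λ t → ⇔.sym (isRootedHom-merge (G₁ ⊕ G₂) left H w roots-distinct t)) ⟩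
    countMaps (pred (n₁ + n₂)) (n H) (isRootedHom? (G₁ ⊕ G₂) left H w ∘ expand roots-distinct)
      ≡⟨ sym (countMaps-identify roots-distinct (isRootedHom? (G₁ ⊕ G₂) left H w)) ⟩
    countMaps (n₁ + n₂) (n H) (λ h → isRootedHom? (G₁ ⊕ G₂) left H w h ×-dec (lookup h left Fin.≟ lookup h right))
      ≡⟨ countMaps-++ _ (isRootedHom? G₁ v₁ H w) (isRootedHom? G₂ v₂ H w) (isRootedHom-⊕ G₁ v₁ G₂ v₂ H w) ⟩
    countMaps n₁ (n H) (isRootedHom? G₁ v₁ H w) * countMaps n₂ (n H) (isRootedHom? G₂ v₂ H w)
      ≡⟨ sym (cong₂ _*_ (homCount-countMaps G₁ v₁ H w) (homCount-countMaps G₂ v₂ H w)) ⟩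
    homCount G₁ v₁ H w * homCount G₂ v₂ H w ∎
    where open ≡-Reasoning

  glue-connected : Connected G₁ → Connected G₂ → Connected glue
  glue-connected conn₁ conn₂ = merge-connected (G₁ ⊕ G₂) roots-distinct (⊕-reach G₁ G₂ conn₁ conn₂ v₁ v₂)

  glue-irreflexive : Irreflexive G₁ → Irreflexive G₂ → Irreflexive glue
  glue-irreflexive irr₁ irr₂ =
    merge-irreflexive (G₁ ⊕ G₂) roots-distinct (⊕-irreflexive G₁ G₂ irr₁ irr₂) (⊕-¬edge G₁ G₂ v₁ v₂)

  glue-bipartite : Bipartite G₁ → Bipartite G₂ → Bipartite glue
  glue-bipartite (c₁ , proper₁) (c₂ , proper₂) with recolour G₂ c₂ proper₂ v₂ (c₁ v₁)
  ... | c₂′ , proper₂′ , same =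
    merge-bipartite (G₁ ⊕ G₂) roots-distinct colour (⊕-bipartite G₁ G₂ c₁ c₂′ proper₁ proper₂′) roots-agree
    where
    colour : Vertex (G₁ ⊕ G₂) → Bool
    colour x = [ c₁ , c₂′ ]′ (splitAt n₁ x)
    roots-agree : colour right ≡ colour left
    roots-agree rewrite splitAt-↑ʳ n₁ n₂ v₂ | splitAt-↑ˡ n₁ v₁ n₂ = same

  glue-hasEdge : HasEdge G₁ → HasEdge glue
  glue-hasEdge (a , b , e) = quotient-hasEdge (G₁ ⊕ G₂) (collapse roots-distinct) (_ , _ , ⊕-edgeˡ G₁ G₂ e)

-- Counting under constraints

data Constraint (K : Set) : Set where
  distinct nonadjacent : K → K → Constraint K

Violates : (H : Graph) {a : ℕ} {K : Set} → (K → Fin a) → Vec (Fin (n H)) a → Constraint K → Set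
Violates H ρ h (distinct x y)    = lookup h (ρ x) ≡ lookup h (ρ y)
Violates H ρ h (nonadjacent x y) = Edge H (lookup h (ρ x)) (lookup h (ρ y))

violates? : ∀ H {a K} (ρ : K → Fin a) h → Decidable (Violates H ρ h)
violates? H ρ h (distinct x y)    = lookup h (ρ x) Fin.≟ lookup h (ρ y)
violates? H ρ h (nonadjacent x y) = edge? H (lookup h (ρ x)) (lookup h (ρ y))

violates-cong : ∀ H {a b K} {ρ : K → Fin a} {σ : K → Fin b} {h t} → (∀ k → lookup h (ρ k) ≡ lookup t (σ k)) →
  ∀ c → Violates H ρ h c ⇔ Violates H σ t c
violates-cong H eq (distinct x y) =
  mk⇔ (λ e → trans (sym (eq x)) (trans e (eq y))) (λ e → trans (eq x) (trans e (sym (eq y))))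
violates-cong H eq (nonadjacent x y) =
  mk⇔ (subst₂ (Edge H) (eq x) (eq y)) (subst₂ (Edge H) (sym (eq x)) (sym (eq y)))

ConstrainedHom : (F : Graph) → Vertex F → (H : Graph) → Vertex H → {K : Set} → (K → Vertex F) →
  List (Constraint K) → Pred (Vec (Fin (n H)) (n F)) 0ℓ
ConstrainedHom F v H w ρ S h = IsRootedHom F v H w h × All (¬_ ∘ Violates H ρ h) S

constrainedHom? : ∀ F v H w {K} (ρ : K → Vertex F) S → Decidable (ConstrainedHom F v H w ρ S)
constrainedHom? F v H w ρ S h = isRootedHom? F v H w h ×-dec all? (¬? ∘ violates? H ρ h) S

constrainedCount : (F : Graph) → Vertex F → (H : Graph) → Vertex H → {K : Set} → (K → Vertex F) →
  List (Constraint K) → ℕ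
constrainedCount F v H w ρ S = countMaps (n F) (n H) (constrainedHom? F v H w ρ S)

module _ (F : Graph) (v : Vertex F) (H : Graph) (w : Vertex H) {K : Set} (ρ : K → Vertex F) where

  constrainedCount-[] : constrainedCount F v H w ρ [] ≡ homCount F v H w
  constrainedCount-[] = trans
    (countMaps-⇔ (constrainedHom? F v H w ρ []) (isRootedHom? F v H w) (λ _ → mk⇔ proj₁ (_, All.[])))
    (sym (homCount-countMaps F v H w))

  constrainedCount-∷ : ∀ c S → constrainedCount F v H w ρ S ≡
    constrainedCount F v H w ρ (c ∷ S) +
    countMaps (n F) (n H) (λ h → constrainedHom? F v H w ρ S h ×-dec violates? H ρ h c)
  constrainedCount-∷ c S =
    trans (countMaps-split (constrainedHom? F v H w ρ S) (λ h → violates? H ρ h c))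
          (cong (_+ countMaps (n F) (n H) (λ h → constrainedHom? F v H w ρ S h ×-dec violates? H ρ h c))
                (countMaps-⇔ _ (constrainedHom? F v H w ρ (c ∷ S)) λ _ → reorder))
    where
    reorder : ∀ {h} → (ConstrainedHom F v H w ρ S h × ¬ Violates H ρ h c) ⇔ ConstrainedHom F v H w ρ (c ∷ S) h
    reorder = mk⇔ (λ ((hom , ok) , okc) → hom , okc ∷ ok) λ { (hom , okc ∷ ok) → (hom , ok) , okc }

  constrainedCount-coincident : ∀ {x y} S → ρ x ≡ ρ y → constrainedCount F v H w ρ (distinct x y ∷ S) ≡ 0
  constrainedCount-coincident S ρx≡ρy =
    countMaps-empty (constrainedHom? F v H w ρ _) λ { h (_ , ok ∷ _) → ok (cong (lookup h) ρx≡ρy) }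

  constrainedCount-distinct : ∀ {x y} S (ρy≢ρx : ρ y ≢ ρ x) →
    constrainedCount F v H w ρ S ≡
      constrainedCount F v H w ρ (distinct x y ∷ S) +
      constrainedCount (merge F ρy≢ρx) (collapse ρy≢ρx v) H w (collapse ρy≢ρx ∘ ρ) S
  constrainedCount-distinct {x} {y} S ρy≢ρx = begin
    constrainedCount F v H w ρ S
      ≡⟨ constrainedCount-∷ (distinct x y) S ⟩
    constrainedCount F v H w ρ (distinct x y ∷ S) + countMaps (n F) (n H) (λ h → P? h ×-dec violates? H ρ h (distinct x y))
      ≡⟨ cong (constrainedCount F v H w ρ (distinct x y ∷ S) +_) (countMaps-identify ρy≢ρx P?) ⟩
    constrainedCount F v H w ρ (distinct x y ∷ S) + countMaps (pred (n F)) (n H) (P? ∘ expand ρy≢ρx)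
      ≡⟨ cong (constrainedCount F v H w ρ (distinct x y ∷ S) +_) (countMaps-⇔ (P? ∘ expand ρy≢ρx) _ merged) ⟩
    constrainedCount F v H w ρ (distinct x y ∷ S) +
      constrainedCount (merge F ρy≢ρx) (collapse ρy≢ρx v) H w (collapse ρy≢ρx ∘ ρ) S ∎
    where
    open ≡-Reasoning
    P? : Decidable (ConstrainedHom F v H w ρ S)
    P? = constrainedHom? F v H w ρ S
    merged : ∀ t → ConstrainedHom F v H w ρ S (expand ρy≢ρx t) ⇔
                   ConstrainedHom (merge F ρy≢ρx) (collapse ρy≢ρx v) H w (collapse ρy≢ρx ∘ ρ) S t
    merged t = mk⇔
      (λ (hom , ok) → Equivalence.to (isRootedHom-merge F v H w ρy≢ρx t) hom ,
                      All.map (λ {c} okc → okc ∘ Equivalence.from (violates-cong H (lookup-expand ρy≢ρx t ∘ ρ) c)) ok)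
      (λ (hom , ok) → Equivalence.from (isRootedHom-merge F v H w ρy≢ρx t) hom ,
                      All.map (λ {c} okc → okc ∘ Equivalence.to (violates-cong H (lookup-expand ρy≢ρx t ∘ ρ) c)) ok)

  constrainedCount-nonadjacent : ∀ {x y} S →
    constrainedCount F v H w ρ S ≡
      constrainedCount F v H w ρ (nonadjacent x y ∷ S) + constrainedCount (addEdge F (ρ x) (ρ y)) v H w ρ S
  constrainedCount-nonadjacent {x} {y} S =
    trans (constrainedCount-∷ (nonadjacent x y) S)
          (cong (constrainedCount F v H w ρ (nonadjacent x y ∷ S) +_) (countMaps-⇔ _ _ withEdge))
    where
    withEdge : ∀ h → (ConstrainedHom F v H w ρ S h × Edge H (lookup h (ρ x)) (lookup h (ρ y))) ⇔
                     ConstrainedHom (addEdge F (ρ x) (ρ y)) v H w ρ S h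
    withEdge h = mk⇔
      (λ ((hom , ok) , e) → Equivalence.from (isRootedHom-addEdge F v H w (ρ x) (ρ y) h) (hom , e) , ok)
      (λ (hom , ok) → let hom′ , e = Equivalence.to (isRootedHom-addEdge F v H w (ρ x) (ρ y) h) hom
                      in (hom′ , ok) , e)

vertexPairs : (F : Graph) → List (Vertex F × Vertex F)
vertexPairs F = cartesianProduct (allFin (n F)) (allFin (n F))

pairConstraints : (F : Graph) → Vertex F × Vertex F → List (Constraint (Vertex F))
pairConstraints F (x , y) with x Fin.≟ y | edge? F x y
... | yes _ | _     = []
... | no _  | yes _ = distinct x y ∷ []
... | no _  | no _  = distinct x y ∷ nonadjacent x y ∷ []

allConstraints : (F : Graph) → List (Constraint (Vertex F))
allConstraints F = concatMap (pairConstraints F) (vertexPairs F)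

module _ (F : Graph) {P : Constraint (Vertex F) → Set} where

  All-allConstraints⁺ : (∀ x y → x ≢ y → P (distinct x y)) → (∀ x y → x ≢ y → ¬ Edge F x y → P (nonadjacent x y)) →
    All P (allConstraints F)
  All-allConstraints⁺ Pd Pn = concat⁺ (map⁺ {xs = vertexPairs F} (All.tabulate λ {(x , y)} _ → pairs x y))
    where
    pairs : ∀ x y → All P (pairConstraints F (x , y))
    pairs x y with x Fin.≟ y | edge? F x y
    ... | yes _   | _      = []
    ... | no x≢y  | yes _  = Pd x y x≢y ∷ []
    ... | no x≢y  | no ¬e  = Pd x y x≢y ∷ Pn x y x≢y ¬e ∷ []

  All-allConstraints⁻ : All P (allConstraints F) → ∀ x y → x ≢ y → P (distinct x y) × (¬ Edge F x y → P (nonadjacent x y))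
  All-allConstraints⁻ all x y x≢y =
    pairs (All.lookup (map⁻ {xs = vertexPairs F} (concat⁻ all)) (∈-cartesianProduct⁺ (∈-allFin x) (∈-allFin y)))
    where
    pairs : All P (pairConstraints F (x , y)) → P (distinct x y) × (¬ Edge F x y → P (nonadjacent x y))
    pairs Ps with x Fin.≟ y | edge? F x y | Ps
    ... | yes x≡y | _     | _             = ⊥-elim (x≢y x≡y)
    ... | no _    | yes e | Pd ∷ []       = Pd , λ ¬e → ⊥-elim (¬e e)
    ... | no _    | no _  | Pd ∷ Pn ∷ []  = Pd , λ _ → Pn

tabulate-rootedHom : ∀ F v H w (f : Vertex F → Vertex H) → f v ≡ w → (∀ x y → Edge F x y → Edge H (f x) (f y)) →
  IsRootedHom F v H w (tabulate f)
tabulate-rootedHom F v H w f root hom =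
  (λ x y e → subst₂ (Edge H) (sym (lookup∘tabulate f x)) (sym (lookup∘tabulate f y)) (hom x y e)) ,
  trans (lookup∘tabulate f v) root

Embedding : (F : Graph) → Vertex F → (H : Graph) → Vertex H → Vec (Fin (n H)) (n F) → Set
Embedding F v H w = ConstrainedHom F v H w id (allConstraints F)

module _ {F : Graph} {v : Vertex F} {H : Graph} {w : Vertex H} where

  embedding-injective : ∀ {t} → Embedding F v H w t → Injective _≡_ _≡_ (lookup t)
  embedding-injective {t} (_ , respected) {x} {y} tx≡ty with x Fin.≟ y
  ... | yes x≡y = x≡y
  ... | no x≢y  = ⊥-elim (proj₁ (All-allConstraints⁻ F respected x y x≢y) tx≡ty)

  embedding-edge⇔ : ∀ {t} → Embedding F v H w t → ∀ x y → x ≢ y → Edge F x y ⇔ Edge H (lookup t x) (lookup t y)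
  embedding-edge⇔ {t} ((hom , _) , respected) x y x≢y = mk⇔ (hom x y) reflect
    where
    reflect : Edge H (lookup t x) (lookup t y) → Edge F x y
    reflect e with edge? F x y
    ... | yes e′ = e′
    ... | no ¬e′ = ⊥-elim (proj₂ (All-allConstraints⁻ F respected x y x≢y) ¬e′ e)

  tabulate-embedding : (f : Vertex F → Vertex H) → f v ≡ w → (∀ x y → Edge F x y → Edge H (f x) (f y)) →
    (∀ x y → x ≢ y → f x ≢ f y) → (∀ x y → x ≢ y → ¬ Edge F x y → ¬ Edge H (f x) (f y)) → Embedding F v H w (tabulate f)
  tabulate-embedding f root hom inj nonedge =
    tabulate-rootedHom F v H w f root hom ,
    All-allConstraints⁺ F
      (λ x y x≢y → subst₂ _≢_ (sym (lookup∘tabulate f x)) (sym (lookup∘tabulate f y)) (inj x y x≢y))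
      (λ x y x≢y ¬e → subst₂ (λ a b → ¬ Edge H a b) (sym (lookup∘tabulate f x)) (sym (lookup∘tabulate f y))
                              (nonedge x y x≢y ¬e))

-- Witness ⊎ (equal counts) is the constructive form of "some graph in C tells H₁ from H₂, or none does".
module HomIndistinguishability
  (H₁ : Graph) (w₁ : Vertex H₁) (H₂ : Graph) (w₂ : Vertex H₂)
  (C : (F : Graph) → Vertex F → Set) (Witness : Set)
  (merge-closed : ∀ F v {q p} (q≢p : q ≢ p) → C F v → C (merge F q≢p) (collapse q≢p v))
  (addEdge-closed : ∀ F v p q → C F v → C (addEdge F p q) v)
  (compare : ∀ F v → C F v → Witness ⊎ homCount F v H₁ w₁ ≡ homCount F v H₂ w₂)
  where

  private
    cancel : ∀ {a₁ a₂ b₁ b₂ x₁ x₂} → a₁ ≡ x₁ + b₁ → a₂ ≡ x₂ + b₂ →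
      Witness ⊎ a₁ ≡ a₂ → Witness ⊎ b₁ ≡ b₂ → Witness ⊎ x₁ ≡ x₂
    cancel _ _ (inj₁ wit) _ = inj₁ wit
    cancel _ _ (inj₂ _) (inj₁ wit) = inj₁ wit
    cancel {b₁ = b₁} {x₁ = x₁} {x₂} split₁ split₂ (inj₂ a₁≡a₂) (inj₂ b₁≡b₂) =
      inj₂ (+-cancelʳ-≡ b₁ x₁ x₂ (trans (sym split₁) (trans a₁≡a₂ (trans split₂ (cong (x₂ +_) (sym b₁≡b₂))))))

  compareConstrained : ∀ {K} (S : List (Constraint K)) F v (ρ : K → Vertex F) → C F v →
    Witness ⊎ constrainedCount F v H₁ w₁ ρ S ≡ constrainedCount F v H₂ w₂ ρ S
  compareConstrained [] F v ρ c with compare F v c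
  ... | inj₁ wit = inj₁ wit
  ... | inj₂ eq  = inj₂ (trans (constrainedCount-[] F v H₁ w₁ ρ) (trans eq (sym (constrainedCount-[] F v H₂ w₂ ρ))))
  compareConstrained (distinct x y ∷ S) F v ρ c with ρ y Fin.≟ ρ x
  ... | yes ρy≡ρx = inj₂ (trans (constrainedCount-coincident F v H₁ w₁ ρ S (sym ρy≡ρx))
                                (sym (constrainedCount-coincident F v H₂ w₂ ρ S (sym ρy≡ρx))))
  ... | no ρy≢ρx  = cancel
    (constrainedCount-distinct F v H₁ w₁ ρ S ρy≢ρx) (constrainedCount-distinct F v H₂ w₂ ρ S ρy≢ρx)
    (compareConstrained S F v ρ c)
    (compareConstrained S (merge F ρy≢ρx) (collapse ρy≢ρx v) (collapse ρy≢ρx ∘ ρ) (merge-closed F v ρy≢ρx c))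
  compareConstrained (nonadjacent x y ∷ S) F v ρ c = cancel
    (constrainedCount-nonadjacent F v H₁ w₁ ρ S) (constrainedCount-nonadjacent F v H₂ w₂ ρ S)
    (compareConstrained S F v ρ c)
    (compareConstrained S (addEdge F (ρ x) (ρ y)) v ρ (addEdge-closed F v (ρ x) (ρ y) c))

  embedding-transfer : ∀ F v → C F v → ∃ (Embedding F v H₁ w₁) → Witness ⊎ ∃ (Embedding F v H₂ w₂)
  embedding-transfer F v c (t , emb) with compareConstrained (allConstraints F) F v id c
  ... | inj₁ wit = inj₁ wit
  ... | inj₂ eq  = inj₂ (countMaps-positive (constrainedHom? F v H₂ w₂ id (allConstraints F))
                     (subst (0 <_) eq (countMaps-witness (constrainedHom? F v H₁ w₁ id (allConstraints F)) t emb)))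

-- Separating two rooted graphs

injective⇒surjective : ∀ {a b} {f : Fin a → Fin b} → Injective _≡_ _≡_ f → b ≤ a → ∀ y → ∃ λ x → f x ≡ y
injective⇒surjective {a} {suc b} {f} f-inj b≤a y with any? (λ x → f x Fin.≟ y)
... | yes found  = found
... | no missing = ⊥-elim (<-irrefl refl (≤-trans b≤a (injective⇒≤ f′-inj)))
  where
  y≢f : ∀ x → y ≢ f x
  y≢f x y≡fx = missing (x , sym y≡fx)
  f′ : Fin a → Fin b
  f′ x = punchOut (y≢f x)
  f′-inj : Injective _≡_ _≡_ f′
  f′-inj {x} {x′} eq = f-inj (punchOut-injective (y≢f x) (y≢f x′) eq)

≡-fromTruth : ∀ {a b : Bool} → (a ≡ true ⇔ b ≡ true) → a ≡ b
≡-fromTruth {true}  {true}  _ = refl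
≡-fromTruth {true}  {false} a⇔b = sym (Equivalence.to a⇔b refl)
≡-fromTruth {false} {true}  a⇔b = Equivalence.from a⇔b refl
≡-fromTruth {false} {false} _ = refl

mutualInjections⇒rootedIso : ∀ H₁ w₁ H₂ w₂ (f : Vertex H₁ → Vertex H₂) {g : Vertex H₂ → Vertex H₁} →
  Injective _≡_ _≡_ f → Injective _≡_ _≡_ g → f w₁ ≡ w₂ → (∀ x y → Edge H₁ x y ⇔ Edge H₂ (f x) (f y)) →
  RootedIso H₁ w₁ H₂ w₂
mutualInjections⇒rootedIso H₁ w₁ H₂ w₂ f f-inj g-inj root edges =
  f , f⁻¹ , (λ x → f-inj (f∘f⁻¹ (f x))) , f∘f⁻¹ , (λ x y → ≡-fromTruth (edges x y)) , root
  where
  onto : ∀ y → ∃ λ x → f x ≡ y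
  onto = injective⇒surjective f-inj (injective⇒≤ g-inj)
  f⁻¹ : Vertex H₂ → Vertex H₁
  f⁻¹ = proj₁ ∘ onto
  f∘f⁻¹ : ∀ y → f (f⁻¹ y) ≡ y
  f∘f⁻¹ = proj₂ ∘ onto

Separator : ((G : Graph) → Vertex G → Set) → (H₁ : Graph) → Vertex H₁ → (H₂ : Graph) → Vertex H₂ → Set
Separator P H₁ w₁ H₂ w₂ = Σ Graph λ G → Σ (Vertex G) λ v → P G v × homCount G v H₁ w₁ ≢ homCount G v H₂ w₂

separator-sym : ∀ {P H₁ w₁ H₂ w₂} → Separator P H₂ w₂ H₁ w₁ → Separator P H₁ w₁ H₂ w₂
separator-sym (G , v , PG , ≢) = G , v , PG , ≢ ∘ sym

positive⇒rootedHom : ∀ F v H w → 0 < homCount F v H w → ∃ (IsRootedHom F v H w)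
positive⇒rootedHom F v H w 0<count =
  countMaps-positive (isRootedHom? F v H w) (subst (0 <_) (homCount-countMaps F v H w) 0<count)

hom⇒irreflexive : ∀ F H h → IsHom F H h → Irreflexive H → Irreflexive F
hom⇒irreflexive F H h hom irr = ¬loop⇒irreflexive F λ x e → irreflexive⇒¬loop H irr (lookup h x) (hom x x e)

hom⇒bipartite : ∀ F H h → IsHom F H h → Bipartite H → Bipartite F
hom⇒bipartite F H h hom (c , proper) = c ∘ lookup h , λ x y e → proper _ _ (hom x y e)

Connected×Irreflexive : (G : Graph) → Vertex G → Set
Connected×Irreflexive G _ = Connected G × Irreflexive G

Connected×Irreflexive×Bipartite×HasEdge : (G : Graph) → Vertex G → Set
Connected×Irreflexive×Bipartite×HasEdge G _ = Connected G × Irreflexive G × Bipartite G × HasEdge G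

homCount-loopless : ∀ F v H w → Reflexive H → homCount (loopless F) v H w ≡ homCount F v H w
homCount-loopless F v H w refl-H = begin
  homCount (loopless F) v H w                            ≡⟨ homCount-countMaps (loopless F) v H w ⟩
  countMaps (n F) (n H) (isRootedHom? (loopless F) v H w) ≡⟨ countMaps-⇔ _ _ (isRootedHom-loopless F v H w refl-H) ⟩
  countMaps (n F) (n H) (isRootedHom? F v H w)            ≡⟨ sym (homCount-countMaps F v H w) ⟩
  homCount F v H w                                       ∎
  where open ≡-Reasoning

module _ (H₁ : Graph) (w₁ : Vertex H₁) (H₂ : Graph) (w₂ : Vertex H₂)
  (refl₁ : Reflexive H₁) (refl₂ : Reflexive H₂) where

  compareLoopless : ∀ F v → Connected F →
    Separator Connected×Irreflexive H₁ w₁ H₂ w₂ ⊎ homCount F v H₁ w₁ ≡ homCount F v H₂ w₂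
  compareLoopless F v conn with homCount (loopless F) v H₁ w₁ ℕ.≟ homCount (loopless F) v H₂ w₂
  ... | no counts≢ = inj₁ (loopless F , v , (loopless-connected F conn , loopless-irreflexive F) , counts≢)
  ... | yes counts≡ = inj₂ (trans (sym (homCount-loopless F v H₁ w₁ refl₁))
                                 (trans counts≡ (homCount-loopless F v H₂ w₂ refl₂)))

  open HomIndistinguishability H₁ w₁ H₂ w₂ (λ F _ → Connected F) (Separator Connected×Irreflexive H₁ w₁ H₂ w₂)
    (λ F v q≢p → quotient-connected F (collapse q≢p) (collapse-surjective q≢p))
    (λ F v p q → addEdge-connected F p q) compareLoopless

  reflexive-separateOrEmbed : Connected H₁ →
    Separator Connected×Irreflexive H₁ w₁ H₂ w₂ ⊎ ∃ (Embedding (loopless H₁) w₁ H₂ w₂)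
  reflexive-separateOrEmbed conn = embedding-transfer (loopless H₁) w₁ (loopless-connected H₁ conn)
    (_ , tabulate-embedding id refl (λ x y → proj₁ ∘ Equivalence.to (loopless-edge⇔ H₁)) (λ x y x≢y → x≢y)
           (λ x y x≢y ¬e → ¬e ∘ Equivalence.from (loopless-edge-≢ H₁ x≢y)))

reflexive-separator : ∀ H₁ w₁ H₂ w₂ → Connected H₁ → Connected H₂ → Reflexive H₁ → Reflexive H₂ →
  ¬ RootedIso H₁ w₁ H₂ w₂ → Separator Connected×Irreflexive H₁ w₁ H₂ w₂
reflexive-separator H₁ w₁ H₂ w₂ conn₁ conn₂ refl₁ refl₂ ¬iso
  with reflexive-separateOrEmbed H₁ w₁ H₂ w₂ refl₁ refl₂ conn₁
     | reflexive-separateOrEmbed H₂ w₂ H₁ w₁ refl₂ refl₁ conn₂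
... | inj₁ sep | _ = sep
... | inj₂ _ | inj₁ sep = separator-sym sep
... | inj₂ (t , emb) | inj₂ (_ , emb′) = ⊥-elim (¬iso (mutualInjections⇒rootedIso H₁ w₁ H₂ w₂ (lookup t)
        (embedding-injective emb) (embedding-injective emb′) (proj₂ (proj₁ emb)) edges))
  where
  edges : ∀ x y → Edge H₁ x y ⇔ Edge H₂ (lookup t x) (lookup t y)
  edges x y with x Fin.≟ y
  ... | yes refl = mk⇔ (λ _ → refl₂ _) (λ _ → refl₁ _)
  ... | no x≢y   = ⇔.trans (⇔.sym (loopless-edge-≢ H₁ x≢y)) (embedding-edge⇔ emb x y x≢y)

module _ (H₁ : Graph) (w₁ : Vertex H₁) (H₂ : Graph) (w₂ : Vertex H₂)
  (irr₁ : Irreflexive H₁) (bip₁ : Bipartite H₁) (irr₂ : Irreflexive H₂) (bip₂ : Bipartite H₂) where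

  compareBipartite : ∀ F v → Connected F × HasEdge F →
    Separator Connected×Irreflexive×Bipartite×HasEdge H₁ w₁ H₂ w₂ ⊎ homCount F v H₁ w₁ ≡ homCount F v H₂ w₂
  compareBipartite F v (conn , edge) with homCount F v H₁ w₁ ℕ.≟ homCount F v H₂ w₂
  ... | yes counts≡ = inj₂ counts≡
  ... | no counts≢ with homCount F v H₁ w₁ ℕ.≟ 0
  ...   | no count₁≢0 =
    let h , hom , _ = positive⇒rootedHom F v H₁ w₁ (n≢0⇒n>0 count₁≢0)
    in inj₁ (F , v , (conn , hom⇒irreflexive F H₁ h hom irr₁ , hom⇒bipartite F H₁ h hom bip₁ , edge) , counts≢)
  ...   | yes count₁≡0 =
    let h , hom , _ = positive⇒rootedHom F v H₂ w₂ (n≢0⇒n>0 λ count₂≡0 → counts≢ (trans count₁≡0 (sym count₂≡0)))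
    in inj₁ (F , v , (conn , hom⇒irreflexive F H₂ h hom irr₂ , hom⇒bipartite F H₂ h hom bip₂ , edge) , counts≢)

  open HomIndistinguishability H₁ w₁ H₂ w₂ (λ F _ → Connected F × HasEdge F)
    (Separator Connected×Irreflexive×Bipartite×HasEdge H₁ w₁ H₂ w₂)
    (λ F v q≢p (conn , edge) → quotient-connected F (collapse q≢p) (collapse-surjective q≢p) conn ,
                               quotient-hasEdge F (collapse q≢p) edge)
    (λ F v p q (conn , edge) → addEdge-connected F p q conn , addEdge-hasEdge F p q edge) compareBipartite

  bipartite-separateOrEmbed : Connected H₁ → HasEdge H₁ →
    Separator Connected×Irreflexive×Bipartite×HasEdge H₁ w₁ H₂ w₂ ⊎ ∃ (Embedding H₁ w₁ H₂ w₂)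
  bipartite-separateOrEmbed conn edge = embedding-transfer H₁ w₁ (conn , edge)
    (_ , tabulate-embedding id refl (λ x y e → e) (λ x y x≢y → x≢y) (λ x y x≢y ¬e → ¬e))

bipartite-separator : ∀ H₁ w₁ H₂ w₂ → Connected H₁ → Connected H₂ →
  Irreflexive H₁ × Bipartite H₁ × HasEdge H₁ → Irreflexive H₂ × Bipartite H₂ × HasEdge H₂ →
  ¬ RootedIso H₁ w₁ H₂ w₂ → Separator Connected×Irreflexive×Bipartite×HasEdge H₁ w₁ H₂ w₂
bipartite-separator H₁ w₁ H₂ w₂ conn₁ conn₂ (irr₁ , bip₁ , edge₁) (irr₂ , bip₂ , edge₂) ¬iso
  with bipartite-separateOrEmbed H₁ w₁ H₂ w₂ irr₁ bip₁ irr₂ bip₂ conn₁ edge₁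
     | bipartite-separateOrEmbed H₂ w₂ H₁ w₁ irr₂ bip₂ irr₁ bip₁ conn₂ edge₂
... | inj₁ sep | _ = sep
... | inj₂ _ | inj₁ sep = separator-sym sep
... | inj₂ (t , emb) | inj₂ (_ , emb′) = ⊥-elim (¬iso (mutualInjections⇒rootedIso H₁ w₁ H₂ w₂ (lookup t)
        (embedding-injective emb) (embedding-injective emb′) (proj₂ (proj₁ emb)) edges))
  where
  edges : ∀ x y → Edge H₁ x y ⇔ Edge H₂ (lookup t x) (lookup t y)
  edges x y with x Fin.≟ y
  ... | yes refl = mk⇔ (⊥-elim ∘ irreflexive⇒¬loop H₁ irr₁ x) (⊥-elim ∘ irreflexive⇒¬loop H₂ irr₂ (lookup t x))
  ... | no x≢y   = embedding-edge⇔ emb x y x≢y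

-- Separating all pairs

bernoulli : ∀ x N → x ^ N * (x + N) ≤ x * suc x ^ N
bernoulli x zero = ≤-reflexive (identity x)
  where
  identity : ∀ x → 1 * (x + 0) ≡ x * 1
  identity = solve-∀
bernoulli x (suc N) = begin
  x ^ suc N * (x + suc N)                ≡⟨ regroup x (x ^ N) N ⟩
  x ^ N * (x * (x + suc N))              ≤⟨ m≤m+n _ _ ⟩
  x ^ N * (x * (x + suc N)) + x ^ N * N  ≡⟨ factor (x ^ N) x N ⟩
  suc x * (x ^ N * (x + N))              ≤⟨ *-monoʳ-≤ (suc x) (bernoulli x N) ⟩
  suc x * (x * suc x ^ N)                ≡⟨ swap x (suc x ^ N) ⟩
  x * (suc x * suc x ^ N)                ∎
  where
  open ≤-Reasoning
  regroup : ∀ x P N → (x * P) * (x + suc N) ≡ P * (x * (x + suc N))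
  regroup = solve-∀
  factor : ∀ P x N → P * (x * (x + suc N)) + P * N ≡ suc x * (P * (x + N))
  factor = solve-∀
  swap : ∀ x Q → suc x * (x * Q) ≡ x * (suc x * Q)
  swap = solve-∀

power-gap : ∀ x y N → 0 < x → x * y ≤ N → x ^ N * y < suc x ^ N
power-gap x@(suc _) y N _ xy≤N = *-cancelˡ-< x (x ^ N * y) (suc x ^ N) (begin-strict
  x * (x ^ N * y)   ≡⟨ swap (x ^ N) x y ⟩
  x ^ N * (x * y)   ≤⟨ *-monoʳ-≤ (x ^ N) xy≤N ⟩
  x ^ N * N         <⟨ *-monoʳ-< (x ^ N) {{m^n≢0 x N}} (m<n+m N (s≤s z≤n)) ⟩
  x ^ N * (x + N)   ≤⟨ bernoulli x N ⟩
  x * suc x ^ N     ∎)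
  where
  open ≤-Reasoning
  swap : ∀ P x y → x * (P * y) ≡ P * (x * y)
  swap = solve-∀

power-weighted-< : ∀ {xa xb ya yb E} → 0 < xa → 0 < yb → xa * ya ≤ E → xa < xb → xa ^ E * ya < xb ^ E * yb
power-weighted-< {xa} {xb} {ya} {yb@(suc _)} {E} 0<xa _ bound xa<xb = begin-strict
  xa ^ E * ya   <⟨ power-gap xa ya E 0<xa bound ⟩
  suc xa ^ E    ≤⟨ ^-monoˡ-≤ E xa<xb ⟩
  xb ^ E        ≤⟨ m≤m*n (xb ^ E) yb ⟩
  xb ^ E * yb   ∎
  where open ≤-Reasoning

power-weighted-injective : ∀ {xa xb ya yb E} → 0 < xa → 0 < xb → 0 < ya → 0 < yb → xa * ya ≤ E → xb * yb ≤ E →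
  xa ^ E * ya ≡ xb ^ E * yb → xa ≡ xb × ya ≡ yb
power-weighted-injective {xa} {xb} {ya} {yb} {E} 0<xa 0<xb 0<ya 0<yb bound-a bound-b eq with <-cmp xa xb
... | tri< xa<xb _ _ = ⊥-elim (<⇒≢ (power-weighted-< 0<xa 0<yb bound-a xa<xb) eq)
... | tri> _ _ xb<xa = ⊥-elim (<⇒≢ (power-weighted-< 0<xb 0<ya bound-b xb<xa) (sym eq))
... | tri≈ _ refl _ = refl , *-cancelˡ-≡ ya yb (xa ^ E) {{m^n≢0 xa E {{>-nonZero 0<xa}}}} eq

powerGraph : (G : Graph) → Vertex G → ℕ → Graph
powerRoot : (G : Graph) (v : Vertex G) (M : ℕ) → Vertex (powerGraph G v M)

powerGraph G v zero    = G
powerGraph G v (suc M) = glue G v (powerGraph G v M) (powerRoot G v M)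

powerRoot G v zero    = v
powerRoot G v (suc M) = glueRoot G v (powerGraph G v M) (powerRoot G v M)

powerGraph-homCount : ∀ G v M H w → homCount (powerGraph G v M) (powerRoot G v M) H w ≡ homCount G v H w ^ suc M
powerGraph-homCount G v zero    H w = sym (*-identityʳ _)
powerGraph-homCount G v (suc M) H w =
  trans (glue-homCount G v (powerGraph G v M) (powerRoot G v M) H w)
        (cong (homCount G v H w *_) (powerGraph-homCount G v M H w))

FamilySeparator : ((G : Graph) → Vertex G → Set) → ∀ {k} (H : Fin k → Graph) → (∀ i → Vertex (H i)) → Set
FamilySeparator P {k} H w =
  Σ Graph λ G → Σ (Vertex G) λ v → P G v × (∀ i j → i ≢ j → homCount G v (H i) (w i) ≢ homCount G v (H j) (w j))

module FamilySeparation {k : ℕ} (H : Fin k → Graph) (w : ∀ i → Vertex (H i))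
  (P : (G : Graph) → Vertex G → Set)
  (P-glue : ∀ {G₁ v₁ G₂ v₂} → P G₁ v₁ → P G₂ v₂ → P (glue G₁ v₁ G₂ v₂) (glueRoot G₁ v₁ G₂ v₂))
  (P-positive : ∀ {G v} → P G v → ∀ i → 0 < homCount G v (H i) (w i))
  (G₀ : Graph) (v₀ : Vertex G₀) (P₀ : P G₀ v₀)
  (separator : ∀ i j → i ≢ j → Separator P (H i) (w i) (H j) (w j))
  where

  profile : (G : Graph) → Vertex G → Fin k → ℕ
  profile G v i = homCount G v (H i) (w i)

  Separates : List (Fin k × Fin k) → (G : Graph) → Vertex G → Set
  Separates L G v = ∀ {i j} → (i , j) ∈ L → i ≢ j → profile G v i ≢ profile G v j

  P-power : ∀ {G v} → P G v → ∀ M → P (powerGraph G v M) (powerRoot G v M)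
  P-power PG zero    = PG
  P-power PG (suc M) = P-glue PG (P-power PG M)

  extend : ∀ {L i₀ j₀} G₁ v₁ → P G₁ v₁ → Separates L G₁ v₁ → ∀ G₂ v₂ → P G₂ v₂ →
    profile G₂ v₂ i₀ ≢ profile G₂ v₂ j₀ → Σ Graph λ G → Σ (Vertex G) λ v → P G v × Separates ((i₀ , j₀) ∷ L) G v
  extend G₁ v₁ P₁ separates₁ G₂ v₂ P₂ differ₂ = G , v , P-glue (P-power P₁ M) P₂ , separates
    where
    x y : Fin k → ℕ
    x = profile G₁ v₁
    y = profile G₂ v₂
    -- M bounds every x i * y i, so the counts x i ^ suc M * y i of G determine x i and y i.
    M : ℕ
    M = sum x * sum y
    G : Graph
    G = glue (powerGraph G₁ v₁ M) (powerRoot G₁ v₁ M) G₂ v₂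
    v : Vertex G
    v = glueRoot (powerGraph G₁ v₁ M) (powerRoot G₁ v₁ M) G₂ v₂
    profile-G : ∀ i → profile G v i ≡ x i ^ suc M * y i
    profile-G i = trans (glue-homCount (powerGraph G₁ v₁ M) (powerRoot G₁ v₁ M) G₂ v₂ (H i) (w i))
                        (cong (_* y i) (powerGraph-homCount G₁ v₁ M (H i) (w i)))
    bound : ∀ i → x i * y i ≤ suc M
    bound i = ≤-trans (*-mono-≤ (term≤sum x i) (term≤sum y i)) (n≤1+n M)
    decode : ∀ a b → profile G v a ≡ profile G v b → x a ≡ x b × y a ≡ y b
    decode a b eq = power-weighted-injective (P-positive P₁ a) (P-positive P₁ b) (P-positive P₂ a) (P-positive P₂ b)
      (bound a) (bound b) (trans (sym (profile-G a)) (trans eq (profile-G b)))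
    separates : Separates _ G v
    separates (here refl) _ eq = differ₂ (proj₂ (decode _ _ eq))
    separates (there m) a≢b eq = separates₁ m a≢b (proj₁ (decode _ _ eq))

  separateAll : ∀ L → Σ Graph λ G → Σ (Vertex G) λ v → P G v × Separates L G v
  separateAll []            = G₀ , v₀ , P₀ , λ ()
  separateAll ((i , j) ∷ L) with separateAll L | i Fin.≟ j
  ... | G₁ , v₁ , P₁ , separates₁ | yes refl = G₁ , v₁ , P₁ , λ { (here refl) i≢i → ⊥-elim (i≢i refl)
                                                                ; (there m) → separates₁ m }
  ... | G₁ , v₁ , P₁ , separates₁ | no i≢j with separator i j i≢j
  ...   | G₂ , v₂ , P₂ , differ₂ = extend G₁ v₁ P₁ separates₁ G₂ v₂ P₂ differ₂

  familySeparator : FamilySeparator P H w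
  familySeparator with separateAll (cartesianProduct (allFin k) (allFin k))
  ... | G , v , PG , separates = G , v , PG , λ i j → separates (∈-cartesianProduct⁺ (∈-allFin i) (∈-allFin j))

complete : ℕ → Graph
complete m = fromRelation m _≢_ (λ x y → ¬? (x Fin.≟ y)) (_∘ sym)

complete-edge⇔ : ∀ m {x y} → Edge (complete m) x y ⇔ (x ≢ y)
complete-edge⇔ m {x} {y} = does≡true⇔ (¬? (x Fin.≟ y))

complete-connected : ∀ m → Connected (complete m)
complete-connected m x y with x Fin.≟ y
... | yes refl = here
... | no x≢y   = step (Equivalence.from (complete-edge⇔ m) x≢y) here

complete-irreflexive : ∀ m → Irreflexive (complete m)
complete-irreflexive m = ¬loop⇒irreflexive (complete m) λ x e → Equivalence.to (complete-edge⇔ m {x} {x}) e refl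

complete₂-bipartite : Bipartite (complete 2)
complete₂-bipartite = colour , λ x y e → proper x y (Equivalence.to (complete-edge⇔ 2) e)
  where
  colour : Fin 2 → Bool
  colour zero    = false
  colour (suc _) = true
  proper : ∀ x y → x ≢ y → colour x ≢ colour y
  proper zero          zero          x≢y _ = x≢y refl
  proper (suc zero)    (suc zero)    x≢y _ = x≢y refl
  proper zero          (suc zero)    _ ()
  proper (suc zero)    zero          _ ()

complete₂-hasEdge : HasEdge (complete 2)
complete₂-hasEdge = zero , suc zero , Equivalence.from (complete-edge⇔ 2 {zero} {suc zero}) λ ()

reflexive-homCount-positive : ∀ G v H w → Reflexive H → 0 < homCount G v H w
reflexive-homCount-positive G v H w refl-H =
  subst (0 <_) (sym (homCount-countMaps G v H w))
    (countMaps-witness (isRootedHom? G v H w) (tabulate (const w))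
                       (tabulate-rootedHom G v H w (const w) refl (λ _ _ _ → refl-H w)))

neighbour : ∀ H → Connected H → HasEdge H → ∀ w → ∃ (Edge H w)
neighbour H conn (x , y , e) w with conn w x
... | here     = y , e
... | step e′ _ = _ , e′

bipartite-homCount-positive : ∀ G v H w → Bipartite G → Connected H → HasEdge H → 0 < homCount G v H w
bipartite-homCount-positive G v H w (c , proper) conn edge =
  subst (0 <_) (sym (homCount-countMaps G v H w))
    (countMaps-witness (isRootedHom? G v H w) (tabulate fold) (tabulate-rootedHom G v H w fold fold-root fold-hom))
  where
  u : Vertex H
  u = proj₁ (neighbour H conn edge w)
  wu : Edge H w u
  wu = proj₂ (neighbour H conn edge w)
  side : ∀ {A : Set} → Dec A → Vertex H
  side (yes _) = w
  side (no _)  = u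
  fold : Vertex G → Vertex H
  fold z = side (c z Bool.≟ c v)
  fold-root : fold v ≡ w
  fold-root with c v Bool.≟ c v
  ... | yes _ = refl
  ... | no cv≢cv = ⊥-elim (cv≢cv refl)
  fold-hom : ∀ x y → Edge G x y → Edge H (fold x) (fold y)
  fold-hom x y e with c x Bool.≟ c v | c y Bool.≟ c v
  ... | yes cx≡cv | yes cy≡cv = ⊥-elim (proper x y e (trans cx≡cv (sym cy≡cv)))
  ... | yes _     | no _      = wu
  ... | no _      | yes _     = edge-sym H wu
  ... | no cx≢cv  | no cy≢cv  = ⊥-elim (proper x y e (trans (¬-not cx≢cv) (sym (¬-not cy≢cv))))

reflexive-familySeparator : ∀ {k} (H : Fin k → Graph) (w : ∀ i → Vertex (H i)) → (∀ i → Connected (H i)) →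
  (∀ i j → i ≢ j → ¬ RootedIso (H i) (w i) (H j) (w j)) → (∀ i → Reflexive (H i)) →
  FamilySeparator Connected×Irreflexive H w
reflexive-familySeparator H w conn ¬iso refl-H = FamilySeparation.familySeparator H w Connected×Irreflexive
  (λ {G₁} {v₁} {G₂} {v₂} (conn₁ , irr₁) (conn₂ , irr₂) →
     glue-connected G₁ v₁ G₂ v₂ conn₁ conn₂ , glue-irreflexive G₁ v₁ G₂ v₂ irr₁ irr₂)
  (λ {G} {v} _ i → reflexive-homCount-positive G v (H i) (w i) (refl-H i))
  (complete 1) zero (complete-connected 1 , complete-irreflexive 1)
  (λ i j i≢j → reflexive-separator (H i) (w i) (H j) (w j) (conn i) (conn j) (refl-H i) (refl-H j) (¬iso i j i≢j))

bipartite-familySeparator : ∀ {k} (H : Fin k → Graph) (w : ∀ i → Vertex (H i)) → (∀ i → Connected (H i)) →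
  (∀ i j → i ≢ j → ¬ RootedIso (H i) (w i) (H j) (w j)) →
  (∀ i → Irreflexive (H i) × Bipartite (H i) × HasEdge (H i)) →
  FamilySeparator Connected×Irreflexive×Bipartite×HasEdge H w
bipartite-familySeparator H w conn ¬iso shape = FamilySeparation.familySeparator H w Connected×Irreflexive×Bipartite×HasEdge
  (λ {G₁} {v₁} {G₂} {v₂} (conn₁ , irr₁ , bip₁ , edge₁) (conn₂ , irr₂ , bip₂ , _) →
     glue-connected G₁ v₁ G₂ v₂ conn₁ conn₂ , glue-irreflexive G₁ v₁ G₂ v₂ irr₁ irr₂ ,
     glue-bipartite G₁ v₁ G₂ v₂ bip₁ bip₂ , glue-hasEdge G₁ v₁ G₂ v₂ edge₁)
  (λ {G} {v} (_ , _ , bipG , _) i →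
     bipartite-homCount-positive G v (H i) (w i) bipG (conn i) (proj₂ (proj₂ (shape i))))
  (complete 2) zero (complete-connected 2 , complete-irreflexive 2 , complete₂-bipartite , complete₂-hasEdge)
  (λ i j i≢j → bipartite-separator (H i) (w i) (H j) (w j) (conn i) (conn j) (shape i) (shape j) (¬iso i j i≢j))

lemma3p11 : (k : ℕ) (H : Fin k → Graph) (w : (i : Fin k) → Vertex (H i)) →
    (∀ i → Connected (H i)) →
    (∀ i j → i ≢ j → ¬ RootedIso (H i) (w i) (H j) (w j)) →
    ((∀ i → Reflexive (H i)) →
      Σ Graph λ G → Σ (Vertex G) λ v →
        Connected G × Irreflexive G ×
        (∀ i j → i ≢ j → homCount G v (H i) (w i) ≢ homCount G v (H j) (w j)))
    ×
    ((∀ i → Irreflexive (H i) × Bipartite (H i) × HasEdge (H i)) →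
      Σ Graph λ G → Σ (Vertex G) λ v →
        Connected G × Irreflexive G × Bipartite G × HasEdge G ×
        (∀ i j → i ≢ j → homCount G v (H i) (w i) ≢ homCount G v (H j) (w j)))
lemma3p11 k H w conn ¬iso =
  (λ refl-H → let G , v , (connG , irrG) , separates = reflexive-familySeparator H w conn ¬iso refl-H
              in G , v , connG , irrG , separates) ,
  (λ shape → let G , v , (connG , irrG , bipG , edgeG) , separates = bipartite-familySeparator H w conn ¬iso shape
             in G , v , connG , irrG , bipG , edgeG , separates)
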